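{- Let $p\ge 5$ be a prime and let $r$ be an integer with $1\le r\le p-1$ such that $4r+1$ is a quadratic non-residue modulo $p$. Then for all integers $n\ge 0$ and all integers $k\ge j\ge 0$, \[ a_{p(k-j)+(p-3),\;pk+p}(pn+r)\equiv 0 \pmod p. \]
   Context: For positive integers $r,s$, $a_{r,s}(n)$ denotes the number of multicolored partitions of $n$ in which each even part may appear in one of $r$ colors and each odd part may appear in one of $s$ colors (copies of the same part size in different colors are distinct), with $a_{r,s}(0)=1$. Equivalently, for $|q|<1$, $\sum_{n\ge0}a_{r,s}(n)q^n = f_2^{s-r}/f_1^{s}$, where $f_m=\prod_{i\ge1}(1-q^{mi})$. -}

module Defs where

open import Data.Nat using (ℕ; zero; suc; _+_; _*_; _∸_; _≤ᵇ_)
open import Data.Nat.Combinatorics using (_C_)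
open import Data.Bool using (if_then_else_)
open import Data.Nat.Divisibility using (_∣_)
open import Data.Product using (∃; _×_)
open import Relation.Nullary using (¬_)
open import Relation.Binary.PropositionalEquality using (_≡_)

even? : ℕ → Data.Bool.Bool
even? zero = Data.Bool.true
even? (suc zero) = Data.Bool.false
even? (suc (suc i)) = even? i

colors : ℕ → ℕ → ℕ → ℕ
colors r s i = if even? i then r else s

-- number of multisets of size j from t colors: C(t+j-1, j)
-- (gives 1 for j = 0, and 0 for t = 0, j > 0)
multichoose : ℕ → ℕ → ℕ
multichoose t j = (t + j ∸ 1) C j

sumTo : ℕ → (ℕ → ℕ) → ℕ
sumTo zero f = f 0
sumTo (suc n) f = sumTo n f + f (suc n)

-- parts r s m n : number of multicolored partitions of n all of whose
-- parts are ≤ m (each even part in one of r colors, each odd part in one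
-- of s colors).  For the largest allowed size m+1 we choose its
-- multiplicity j, and a multiset of j colors for those j copies.
parts : ℕ → ℕ → ℕ → ℕ → ℕ
parts r s zero zero = 1
parts r s zero (suc n) = 0
parts r s (suc m) n =
  sumTo n (λ j → if j * suc m ≤ᵇ n
                   then multichoose (colors r s (suc m)) j * parts r s m (n ∸ j * suc m)
                   else 0)

a : ℕ → ℕ → ℕ → ℕ
a r s n = parts r s n n

QNR : ℕ → ℕ → Set
-- (x² ≡ m mod p written as x*x + p*y ≡ m + p*z for some y z)
QNR p m = ¬ (p ∣ m) × ¬ (∃ λ x → ∃ λ y → ∃ λ z → x * x + p * y ≡ m + p * z)

-- The generating function f₂^(s-r) / f₁^s of a_{r,s} is that of a_{r+3,s} times f₂³.  For
-- r + 3 = p(k-j+1) and s = p(k+1) the former is a product of powers of (1 - q^i)^(-p), whose coefficient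
-- C(p+m-1, m) at q^(im) is divisible by p unless p ∣ m; so modulo p it only has terms q^(pc).  By
-- Jacobi's identity f₁³ = Σ (-1)^j (2j+1) q^(j(j+1)/2), the series f₂³ only has terms q^(j(j+1)).
-- A term of q^(pn+r) in the product that survives modulo p therefore needs pc + j(j+1) = pn + r, i.e.
-- (2j+1)² ≡ 4r+1 (mod p), which is impossible for a non-residue.  All series are truncated, and
-- Jacobi's identity is used in the finite form
--   Σ_{j+m=n} (2j+1) (-1)^j y^(j(j+1)/2) (y^(m+1); y)_j (y^(2j+m+2); y)_m = (y; y)_n³,
-- proved by induction on n with a telescoping certificate.
module Submission where

open import Data.Nat.Base using (ℕ)

module PowerSeries where

  open import Algebra.Bundles using (CommutativeRing)
  open import Algebra.Structures using (IsCommutativeRing)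
  import Algebra.Solver.Ring.AlmostCommutativeRing as ACR
  open import Data.Integer.Base using (ℤ; +_; -_; _+_; _*_; 0ℤ; 1ℤ)
  import Data.Integer.Base as ℤ
  import Data.Integer.Properties as ℤ
  open import Algebra.Properties.CommutativeSemigroup ℤ.+-commutativeSemigroup using (interchange)
  open import Data.Integer.Divisibility.Signed using (_∣_; ∣m∣n⇒∣m+n)
  open import Data.Vec.Base using (Vec; lookup; map)
  import Data.Vec.Properties as Vec
  open import Data.Vec.Relation.Binary.Pointwise.Inductive as Pointwise using (Pointwise)
  open import Data.Integer.Tactic.RingSolver using (solve-∀)
  open import Data.Maybe.Base using (Maybe; just; nothing)
  open import Data.Nat.Base as ℕ using (ℕ; zero; suc; _<_; _≤_; z≤n; s≤s)
  import Data.Nat.Properties as ℕ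
  open import Data.Product.Base using (_,_)
  open import Level using (0ℓ)
  open import Relation.Binary.Core using (Rel)
  open import Relation.Binary.PropositionalEquality
  open import Relation.Nullary.Decidable using (yes; no)

  Series : Set
  Series = ℕ → ℤ

  infix 4 _≋_ _≋[<_]_
  infixl 6 _⊕_
  infixl 7 _⊛_
  infix 8 ⊝_

  _≋_ : Rel Series 0ℓ
  F ≋ G = ∀ n → F n ≡ G n

  _≋[<_]_ : Series → ℕ → Series → Set
  F ≋[< M ] G = ∀ n → n < M → F n ≡ G n

  const : ℤ → Series
  const c zero    = c
  const c (suc _) = 0ℤ

  𝟘 𝟙 : Series
  𝟘 _ = 0ℤ
  𝟙 = const 1ℤ

  _⊕_ : Series → Series → Series
  (F ⊕ G) n = F n + G n

  ⊝_ : Series → Series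
  (⊝ F) n = - F n

  ≋-refl : ∀ {F} → F ≋ F
  ≋-refl _ = refl

  ≋-reflexive : ∀ {F G} → F ≡ G → F ≋ G
  ≋-reflexive refl = ≋-refl

  ≋-sym : ∀ {F G} → F ≋ G → G ≋ F
  ≋-sym F≋G n = sym (F≋G n)

  ≋-trans : ∀ {F G H} → F ≋ G → G ≋ H → F ≋ H
  ≋-trans F≋G G≋H n = trans (F≋G n) (G≋H n)

  ⊕-cong : ∀ {F F′ G G′} → F ≋ F′ → G ≋ G′ → F ⊕ G ≋ F′ ⊕ G′
  ⊕-cong eF eG n = cong₂ _+_ (eF n) (eG n)

  ⊝-cong : ∀ {F F′} → F ≋ F′ → ⊝ F ≋ ⊝ F′
  ⊝-cong eF n = cong -_ (eF n)

  tail : Series → Series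
  tail F n = F (suc n)

  _⊛_ : Series → Series → Series
  (F ⊛ G) zero    = F 0 * G 0
  (F ⊛ G) (suc n) = F 0 * G (suc n) + (tail F ⊛ G) n

  ⊛-local : ∀ n {F F′ G G′} → F ≋[< suc n ] F′ → G ≋[< suc n ] G′ → (F ⊛ G) n ≡ (F′ ⊛ G′) n
  ⊛-local zero    eF eG = cong₂ _*_ (eF 0 (s≤s z≤n)) (eG 0 (s≤s z≤n))
  ⊛-local (suc n) eF eG = cong₂ _+_ (cong₂ _*_ (eF 0 (s≤s z≤n)) (eG (suc n) ℕ.≤-refl))
    (⊛-local n (λ i i<1+n → eF (suc i) (s≤s i<1+n)) (λ i i<1+n → eG i (ℕ.m<n⇒m<1+n i<1+n)))

  ⊛-congᴹ : ∀ {M F F′ G G′} → F ≋[< M ] F′ → G ≋[< M ] G′ → F ⊛ G ≋[< M ] F′ ⊛ G′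
  ⊛-congᴹ eF eG n n<M =
    ⊛-local n (λ i i<1+n → eF i (ℕ.<-≤-trans i<1+n n<M)) (λ i i<1+n → eG i (ℕ.<-≤-trans i<1+n n<M))

  ⊛-cong : ∀ {F F′ G G′} → F ≋ F′ → G ≋ G′ → F ⊛ G ≋ F′ ⊛ G′
  ⊛-cong eF eG n = ⊛-local n (λ i _ → eF i) (λ i _ → eG i)

  ⊛-suc-right : ∀ n F G → (F ⊛ G) (suc n) ≡ (F ⊛ tail G) n + F (suc n) * G 0
  ⊛-suc-right zero    F G = refl
  ⊛-suc-right (suc n) F G = begin
    F 0 * G (suc (suc n)) + (tail F ⊛ G) (suc n)
      ≡⟨ cong (λ u → F 0 * G (suc (suc n)) + u) (⊛-suc-right n (tail F) G) ⟩
    F 0 * G (suc (suc n)) + ((tail F ⊛ tail G) n + F (suc (suc n)) * G 0)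
      ≡⟨ ℤ.+-assoc (F 0 * G (suc (suc n))) _ _ ⟨
    F 0 * G (suc (suc n)) + (tail F ⊛ tail G) n + F (suc (suc n)) * G 0 ∎
    where open ≡-Reasoning

  ⊛-comm : ∀ F G → F ⊛ G ≋ G ⊛ F
  ⊛-comm F G zero    = ℤ.*-comm (F 0) (G 0)
  ⊛-comm F G (suc n) = begin
    F 0 * G (suc n) + (tail F ⊛ G) n  ≡⟨ cong₂ _+_ (ℤ.*-comm (F 0) (G (suc n))) (⊛-comm (tail F) G n) ⟩
    G (suc n) * F 0 + (G ⊛ tail F) n  ≡⟨ ℤ.+-comm (G (suc n) * F 0) _ ⟩
    (G ⊛ tail F) n + G (suc n) * F 0  ≡⟨ ⊛-suc-right n G F ⟨
    (G ⊛ F) (suc n)                   ∎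
    where open ≡-Reasoning

  ⊕-identityʳ : ∀ F → F ⊕ 𝟘 ≋ F
  ⊕-identityʳ F n = ℤ.+-identityʳ (F n)

  ⊛-zeroˡ : ∀ F → 𝟘 ⊛ F ≋ 𝟘
  ⊛-zeroˡ F zero    = refl
  ⊛-zeroˡ F (suc n) = trans (ℤ.+-identityˡ _) (⊛-zeroˡ F n)

  const-⊛ : ∀ c F n → (const c ⊛ F) n ≡ c * F n
  const-⊛ c F zero    = refl
  const-⊛ c F (suc n) = trans (cong (λ u → c * F (suc n) + u) (⊛-zeroˡ F n)) (ℤ.+-identityʳ _)

  ⊛-identityˡ : ∀ F → 𝟙 ⊛ F ≋ F
  ⊛-identityˡ F n = trans (const-⊛ 1ℤ F n) (ℤ.*-identityˡ (F n))

  ⊛-distribʳ : ∀ H F G → (F ⊕ G) ⊛ H ≋ F ⊛ H ⊕ G ⊛ H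
  ⊛-distribʳ H F G zero    = ℤ.*-distribʳ-+ (H 0) (F 0) (G 0)
  ⊛-distribʳ H F G (suc n) = begin
    (F 0 + G 0) * H (suc n) + ((tail F ⊕ tail G) ⊛ H) n
      ≡⟨ cong₂ _+_ (ℤ.*-distribʳ-+ (H (suc n)) (F 0) (G 0)) (⊛-distribʳ H (tail F) (tail G) n) ⟩
    (F 0 * H (suc n) + G 0 * H (suc n)) + ((tail F ⊛ H) n + (tail G ⊛ H) n)
      ≡⟨ interchange (F 0 * H (suc n)) (G 0 * H (suc n)) _ _ ⟩
    (F 0 * H (suc n) + (tail F ⊛ H) n) + (G 0 * H (suc n) + (tail G ⊛ H) n) ∎
    where open ≡-Reasoning

  ⊛-distribˡ : ∀ H F G → H ⊛ (F ⊕ G) ≋ H ⊛ F ⊕ H ⊛ G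
  ⊛-distribˡ H F G n =
    trans (⊛-comm H (F ⊕ G) n) (trans (⊛-distribʳ H F G n) (cong₂ _+_ (⊛-comm F H n) (⊛-comm G H n)))

  scale : ℤ → Series → Series
  scale c F n = c * F n

  scale-⊛ : ∀ c F G → scale c F ⊛ G ≋ scale c (F ⊛ G)
  scale-⊛ c F G zero    = ℤ.*-assoc c (F 0) (G 0)
  scale-⊛ c F G (suc n) = begin
    c * F 0 * G (suc n) + (scale c (tail F) ⊛ G) n
      ≡⟨ cong₂ _+_ (ℤ.*-assoc c (F 0) (G (suc n))) (scale-⊛ c (tail F) G n) ⟩
    c * (F 0 * G (suc n)) + c * (tail F ⊛ G) n
      ≡⟨ ℤ.*-distribˡ-+ c _ _ ⟨
    c * (F 0 * G (suc n) + (tail F ⊛ G) n) ∎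
    where open ≡-Reasoning

  ⊛-assoc : ∀ F G H → (F ⊛ G) ⊛ H ≋ F ⊛ (G ⊛ H)
  ⊛-assoc F G H zero    = ℤ.*-assoc (F 0) (G 0) (H 0)
  ⊛-assoc F G H (suc n) = begin
    F 0 * G 0 * H (suc n) + ((scale (F 0) (tail G) ⊕ tail F ⊛ G) ⊛ H) n
      ≡⟨ cong (λ u → F 0 * G 0 * H (suc n) + u) (⊛-distribʳ H (scale (F 0) (tail G)) (tail F ⊛ G) n) ⟩
    F 0 * G 0 * H (suc n) + ((scale (F 0) (tail G) ⊛ H) n + ((tail F ⊛ G) ⊛ H) n)
      ≡⟨ cong₂ (λ u v → F 0 * G 0 * H (suc n) + (u + v)) (scale-⊛ (F 0) (tail G) H n) (⊛-assoc (tail F) G H n) ⟩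
    F 0 * G 0 * H (suc n) + (F 0 * (tail G ⊛ H) n + (tail F ⊛ (G ⊛ H)) n)
      ≡⟨ regroup (F 0) (G 0) (H (suc n)) _ _ ⟩
    F 0 * (G 0 * H (suc n) + (tail G ⊛ H) n) + (tail F ⊛ (G ⊛ H)) n ∎
    where
    open ≡-Reasoning
    regroup : ∀ a b c d e → a * b * c + (a * d + e) ≡ a * (b * c + d) + e
    regroup = solve-∀

  series-isCommutativeRing : IsCommutativeRing _≋_ _⊕_ _⊛_ ⊝_ 𝟘 𝟙
  series-isCommutativeRing = record
    { isRing = record
      { +-isAbelianGroup = record
        { isGroup = record
          { isMonoid = record
            { isSemigroup = record
              { isMagma = record
                { isEquivalence = record { refl = ≋-refl ; sym = ≋-sym ; trans = ≋-trans }
                ; ∙-cong = ⊕-cong }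
              ; assoc = λ F G H n → ℤ.+-assoc (F n) (G n) (H n) }
            ; identity = (λ F n → ℤ.+-identityˡ (F n)) , (λ F n → ℤ.+-identityʳ (F n)) }
          ; inverse = (λ F n → ℤ.+-inverseˡ (F n)) , (λ F n → ℤ.+-inverseʳ (F n))
          ; ⁻¹-cong = ⊝-cong }
        ; comm = λ F G n → ℤ.+-comm (F n) (G n) }
      ; *-cong = ⊛-cong
      ; *-assoc = ⊛-assoc
      ; *-identity = ⊛-identityˡ , (λ F n → trans (⊛-comm F 𝟙 n) (⊛-identityˡ F n))
      ; distrib = ⊛-distribˡ , ⊛-distribʳ }
    ; *-comm = ⊛-comm }

  series-commutativeRing : CommutativeRing 0ℓ 0ℓ
  series-commutativeRing = record { isCommutativeRing = series-isCommutativeRing }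

  open CommutativeRing series-commutativeRing public using (semiring) renaming (setoid to ≋-setoid)

  const-* : ∀ a b → const (a * b) ≋ const a ⊛ const b
  const-* a b zero    = refl
  const-* a b (suc n) = sym (trans (const-⊛ a (const b) (suc n)) (ℤ.*-zeroʳ a))

  series-almostCommutativeRing : ACR.AlmostCommutativeRing 0ℓ 0ℓ
  series-almostCommutativeRing = ACR.fromCommutativeRing series-commutativeRing

  const-homomorphism : ℤ.+-*-rawRing ACR.-Raw-AlmostCommutative⟶ series-almostCommutativeRing
  const-homomorphism = record
    { ⟦_⟧    = const
    ; +-homo = λ { a b zero → refl ; a b (suc n) → refl }
    ; *-homo = const-*
    ; -‿homo = λ { a zero → refl ; a (suc n) → refl }
    ; 0-homo = λ { zero → refl ; (suc n) → refl }
    ; 1-homo = λ n → refl }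

  const-≟ : (a b : ℤ) → Maybe (const a ≋ const b)
  const-≟ a b with a ℤ.≟ b
  ... | yes refl = just ≋-refl
  ... | no _     = nothing

  open import Algebra.Solver.Ring ℤ.+-*-rawRing series-almostCommutativeRing const-homomorphism const-≟ public
    using (Polynomial; op; [+]; [*]; con; var; _:^_; :-_; _:+_; _:*_; ⟦_⟧; ⟦_⟧↓; prove; solve; _:=_)
  open import Algebra.Properties.Semiring.Exp semiring public using (_^_; ^-congˡ; ^-assocʳ)

  substitute : ∀ {k l} → Polynomial k → Vec (Polynomial l) k → Polynomial l
  substitute (op o p p′) qs = op o (substitute p qs) (substitute p′ qs)
  substitute (con c)     qs = con c
  substitute (var x)     qs = lookup qs x
  substitute (p :^ n)    qs = substitute p qs :^ n
  substitute (:- p)      qs = :- substitute p qs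

  ⟦⟧-cong : ∀ {k} (p : Polynomial k) {ρ ρ′} → Pointwise _≋_ ρ ρ′ → ⟦ p ⟧ ρ ≋ ⟦ p ⟧ ρ′
  ⟦⟧-cong (op [+] p p′) ρ≋ρ′ = ⊕-cong (⟦⟧-cong p ρ≋ρ′) (⟦⟧-cong p′ ρ≋ρ′)
  ⟦⟧-cong (op [*] p p′) ρ≋ρ′ = ⊛-cong (⟦⟧-cong p ρ≋ρ′) (⟦⟧-cong p′ ρ≋ρ′)
  ⟦⟧-cong (con c)       ρ≋ρ′ = ≋-refl
  ⟦⟧-cong (var x)       ρ≋ρ′ = Pointwise.lookup ρ≋ρ′ x
  ⟦⟧-cong (p :^ n)      ρ≋ρ′ = ^-congˡ n (⟦⟧-cong p ρ≋ρ′)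
  ⟦⟧-cong (:- p)        ρ≋ρ′ = ⊝-cong (⟦⟧-cong p ρ≋ρ′)

  ⟦substitute⟧ : ∀ {k l} (p : Polynomial k) qs (σ : Vec Series l) →
                 ⟦ substitute p qs ⟧ σ ≋ ⟦ p ⟧ (map (λ q → ⟦ q ⟧ σ) qs)
  ⟦substitute⟧ (op [+] p p′) qs σ = ⊕-cong (⟦substitute⟧ p qs σ) (⟦substitute⟧ p′ qs σ)
  ⟦substitute⟧ (op [*] p p′) qs σ = ⊛-cong (⟦substitute⟧ p qs σ) (⟦substitute⟧ p′ qs σ)
  ⟦substitute⟧ (con c)       qs σ = ≋-refl
  ⟦substitute⟧ (var x)       qs σ = ≋-reflexive (sym (Vec.lookup-map x (λ q → ⟦ q ⟧ σ) qs))
  ⟦substitute⟧ (p :^ n)      qs σ = ^-congˡ n (⟦substitute⟧ p qs σ)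
  ⟦substitute⟧ (:- p)        qs σ = ⊝-cong (⟦substitute⟧ p qs σ)

  -- The ring solver cannot use relations between the entries of ρ; rewriting every entry as a
  -- polynomial in the series σ first builds those relations in.
  by-substitution : ∀ {k l} (p p′ : Polynomial k) qs {ρ} (σ : Vec Series l) →
                    Pointwise _≋_ ρ (map (λ q → ⟦ q ⟧ σ) qs) →
                    ⟦ substitute p qs ⟧↓ σ ≋ ⟦ substitute p′ qs ⟧↓ σ → ⟦ p ⟧ ρ ≋ ⟦ p′ ⟧ ρ
  by-substitution p p′ qs σ ρ≋qs nf = begin
    ⟦ p ⟧ _                          ≈⟨ ⟦⟧-cong p ρ≋qs ⟩
    ⟦ p ⟧ (map (λ q → ⟦ q ⟧ σ) qs)   ≈⟨ ⟦substitute⟧ p qs σ ⟨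
    ⟦ substitute p qs ⟧ σ            ≈⟨ prove σ (substitute p qs) (substitute p′ qs) nf ⟩
    ⟦ substitute p′ qs ⟧ σ           ≈⟨ ⟦substitute⟧ p′ qs σ ⟩
    ⟦ p′ ⟧ (map (λ q → ⟦ q ⟧ σ) qs)  ≈⟨ ⟦⟧-cong p′ ρ≋qs ⟨
    ⟦ p′ ⟧ _                         ∎
    where open import Relation.Binary.Reasoning.Setoid ≋-setoid

  q^_ : ℕ → Series
  (q^ zero)              = 𝟙
  (q^ suc e) zero    = 0ℤ
  (q^ suc e) (suc n) = (q^ e) n

  shift : ℕ → Series → Series
  shift zero    F         = F
  shift (suc d) F zero    = 0ℤ
  shift (suc d) F (suc n) = shift d F n

  q^-⊛ : ∀ d F → q^ d ⊛ F ≋ shift d F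
  q^-⊛ zero    F         = ⊛-identityˡ F
  q^-⊛ (suc d) F zero    = refl
  q^-⊛ (suc d) F (suc n) = trans (ℤ.+-identityˡ _) (q^-⊛ d F n)

  shift-below : ∀ d F n → n < d → shift d F n ≡ 0ℤ
  shift-below (suc d) F zero    _         = refl
  shift-below (suc d) F (suc n) (s≤s n<d) = shift-below d F n n<d

  shift-above : ∀ d F n → shift d F (d ℕ.+ n) ≡ F n
  shift-above zero    F n = refl
  shift-above (suc d) F n = shift-above d F n

  shift-q^ : ∀ d e → shift d (q^ e) ≋ q^ (d ℕ.+ e)
  shift-q^ zero    e         = ≋-refl
  shift-q^ (suc d) e zero    = refl
  shift-q^ (suc d) e (suc n) = shift-q^ d e n

  q^-+ : ∀ d e → q^ (d ℕ.+ e) ≋ q^ d ⊛ q^ e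
  q^-+ d e = ≋-sym (≋-trans (q^-⊛ d (q^ e)) (shift-q^ d e))

  q^-below : ∀ e n → n < e → (q^ e) n ≡ 0ℤ
  q^-below (suc e) zero    _         = refl
  q^-below (suc e) (suc n) (s≤s n<e) = q^-below e n n<e

  ≋[<]-weaken : ∀ {M M′ F G} → M′ ≤ M → F ≋[< M ] G → F ≋[< M′ ] G
  ≋[<]-weaken M′≤M F≋G n n<M′ = F≋G n (ℕ.<-≤-trans n<M′ M′≤M)

  ⊛-≋[<]𝟙 : ∀ {M F G} → F ≋[< M ] 𝟙 → G ≋[< M ] 𝟙 → F ⊛ G ≋[< M ] 𝟙
  ⊛-≋[<]𝟙 F≋𝟙 G≋𝟙 n n<M = trans (⊛-congᴹ F≋𝟙 G≋𝟙 n n<M) (⊛-identityˡ 𝟙 n)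

  1-q^≋[<]𝟙 : ∀ e → 𝟙 ⊕ ⊝ q^ e ≋[< e ] 𝟙
  1-q^≋[<]𝟙 e n n<e = trans (cong (λ c → 𝟙 n + - c) (q^-below e n n<e)) (ℤ.+-identityʳ (𝟙 n))

  ∣-⊛ : ∀ {k} n F G → (∀ i j → i ℕ.+ j ≡ n → k ∣ F i * G j) → k ∣ (F ⊛ G) n
  ∣-⊛ zero    F G k∣ = k∣ 0 0 refl
  ∣-⊛ (suc n) F G k∣ = ∣m∣n⇒∣m+n (k∣ 0 (suc n) refl) (∣-⊛ n (tail F) G (λ i j eq → k∣ (suc i) j (cong suc eq)))

  ∑-antidiagonal : ℕ → (ℕ → ℕ → Series) → Series
  ∑-antidiagonal zero    f = f 0 0
  ∑-antidiagonal (suc n) f = ∑-antidiagonal n (λ j m → f j (suc m)) ⊕ f (suc n) 0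

  ∑-antidiagonal-cong : ∀ n {f g} → (∀ j m → j ℕ.+ m ≡ n → f j m ≋ g j m) → ∑-antidiagonal n f ≋ ∑-antidiagonal n g
  ∑-antidiagonal-cong zero    f≋g = f≋g 0 0 refl
  ∑-antidiagonal-cong (suc n) f≋g = ⊕-cong
    (∑-antidiagonal-cong n (λ j m j+m≡n → f≋g j (suc m) (trans (ℕ.+-suc j m) (cong suc j+m≡n))))
    (f≋g (suc n) 0 (ℕ.+-identityʳ (suc n)))

  ∑-antidiagonal-⊕ : ∀ n f g → ∑-antidiagonal n (λ j m → f j m ⊕ g j m) ≋ ∑-antidiagonal n f ⊕ ∑-antidiagonal n g
  ∑-antidiagonal-⊕ zero    f g = ≋-refl
  ∑-antidiagonal-⊕ (suc n) f g t = trans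
    (cong (_+ (f (suc n) 0 t + g (suc n) 0 t)) (∑-antidiagonal-⊕ n (λ j m → f j (suc m)) (λ j m → g j (suc m)) t))
    (interchange (∑-antidiagonal n (λ j m → f j (suc m)) t) (∑-antidiagonal n (λ j m → g j (suc m)) t) _ _)

  ∑-antidiagonal-⊛ : ∀ n H f → ∑-antidiagonal n (λ j m → H ⊛ f j m) ≋ H ⊛ ∑-antidiagonal n f
  ∑-antidiagonal-⊛ zero    H f = ≋-refl
  ∑-antidiagonal-⊛ (suc n) H f =
    ≋-trans (⊕-cong (∑-antidiagonal-⊛ n H (λ j m → f j (suc m))) ≋-refl) (≋-sym (⊛-distribˡ H _ _))

  ∑-antidiagonal-telescope : ∀ n (E : ℕ → ℕ → Series) → ∑-antidiagonal n (λ j m → E (suc j) m ⊕ ⊝ E j (suc m)) ≋ E (suc n) 0 ⊕ ⊝ E 0 (suc n)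
  ∑-antidiagonal-telescope zero    E = ≋-refl
  ∑-antidiagonal-telescope (suc n) E t = trans
    (cong (_+ (E (suc (suc n)) 0 t + - E (suc n) 1 t)) (∑-antidiagonal-telescope n (λ j m → E j (suc m)) t))
    (cancel (E (suc n) 1 t) (E 0 (suc (suc n)) t) (E (suc (suc n)) 0 t))
    where
    cancel : ∀ a b c → (a + - b) + (c + - a) ≡ c + - b
    cancel = solve-∀

  ∑-antidiagonal-vanishes : ∀ n f t → (∀ j m → j ℕ.+ m ≡ n → f j m t ≡ 0ℤ) → ∑-antidiagonal n f t ≡ 0ℤ
  ∑-antidiagonal-vanishes zero    f t f≡0 = f≡0 0 0 refl
  ∑-antidiagonal-vanishes (suc n) f t f≡0 = cong₂ _+_
    (∑-antidiagonal-vanishes n (λ j m → f j (suc m)) t (λ j m j+m≡n → f≡0 j (suc m) (trans (ℕ.+-suc j m) (cong suc j+m≡n))))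
    (f≡0 (suc n) 0 (ℕ.+-identityʳ (suc n)))


module TriangularNumbers where

  open import Data.Nat.Base using (ℕ; zero; suc; _+_; _*_; _≤_; z≤n)
  import Data.Nat.Properties as ℕ
  import Data.Nat.Tactic.RingSolver as ℕ-Solver
  open import Relation.Binary.PropositionalEquality using (_≡_; refl; cong; trans)

  tri : ℕ → ℕ
  tri zero    = 0
  tri (suc j) = suc j + tri j

  j≤tri : ∀ j → j ≤ tri j
  j≤tri zero    = z≤n
  j≤tri (suc j) = ℕ.m≤m+n (suc j) (tri j)

  2*tri≡j*[1+j] : ∀ j → 2 * tri j ≡ j * suc j
  2*tri≡j*[1+j] zero    = refl
  2*tri≡j*[1+j] (suc j) = trans (ℕ.*-distribˡ-+ 2 (suc j) (tri j)) (trans (cong (2 * suc j +_) (2*tri≡j*[1+j] j)) (step j))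
    where
    step : ∀ j → 2 * suc j + j * suc j ≡ suc j * suc (suc j)
    step = ℕ-Solver.solve-∀


module Jacobi (d : ℕ) where

  open PowerSeries
  open TriangularNumbers
  open import Data.Fin using (#_)
  open import Data.Integer.Base using (+_; 0ℤ; 1ℤ)
  import Data.Integer.Base as ℤ
  import Data.Integer.Properties as ℤ
  open import Data.List.Base using ([]; _∷_; foldl)
  open import Data.Nat.Base using (ℕ; zero; suc; _+_; _*_; _<_; _≤_; z≤n; s≤s)
  import Data.Nat.Properties as ℕ
  import Data.Nat.Tactic.RingSolver as ℕ-Solver
  open import Data.Product.Base using (_,_)
  open import Data.Sum.Base using (_⊎_; inj₁; inj₂)
  open import Data.Vec.Base using (Vec; []; _∷_; map)
  open import Data.Vec.Relation.Binary.Pointwise.Inductive using (Pointwise; []; _∷_)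
  open import Relation.Binary.PropositionalEquality using (_≡_; _≢_; refl; cong; sym; trans; subst; module ≡-Reasoning)
  open import Relation.Nullary.Decidable using (yes; no)
  open import Relation.Nullary.Negation using (contradiction)

  y^_ : ℕ → Series
  y^ e = q^ (d * e)

  1-y^_ : ℕ → Series
  1-y^ e = 𝟙 ⊕ ⊝ y^ e

  -- poch a k is the q-Pochhammer symbol (y^(a+1); y)_k = ∏_{i=1}^{k} (1 - y^(a+i)).
  poch : ℕ → ℕ → Series
  poch a zero    = 𝟙
  poch a (suc k) = poch a k ⊛ 1-y^ (a + suc k)

  signedTri : ℕ → Series
  signedTri zero    = 𝟙
  signedTri (suc j) = ⊝ (y^ suc j ⊛ signedTri j)

  odd⁺ odd⁻ : ℕ → Series
  odd⁺ j = const (+ j) ⊕ const (+ j) ⊕ 𝟙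
  odd⁻ j = const (+ j) ⊕ const (+ j) ⊕ ⊝ 𝟙

  jacobiTerm : ℕ → Series
  jacobiTerm j = odd⁺ j ⊛ signedTri j

  weight : ℕ → ℕ → Series
  weight j m = poch m j ⊛ poch (suc (j + m + j)) m

  jacobiSum : ℕ → Series
  jacobiSum n = ∑-antidiagonal n (λ j m → jacobiTerm j ⊛ weight j m)

  difference : ℕ → ℕ → Series
  difference j m = jacobiTerm j ⊛ weight j (suc m) ⊕ ⊝ ((1-y^ suc (j + m)) ^ 3 ⊛ (jacobiTerm j ⊛ weight j m))

  certificate : ℕ → ℕ → Series
  certificate j zero    = ⊝ (signedTri j ⊛ poch 0 j ⊛ odd⁺ j)
  certificate j (suc m) = ⊝ (signedTri j ⊛ y^ suc m ⊛ poch (suc m) j ⊛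
    (odd⁺ j ⊛ poch (j + m + j) (suc m) ⊕ odd⁻ j ⊛ (y^ j ⊕ ⊝ y^ suc (j + m)) ⊛ poch (suc (j + m + j)) m))

  y^-∑ : ∀ {e} a es → e ≡ foldl _+_ a es → y^ e ≋ foldl (λ F b → F ⊛ y^ b) (y^ a) es
  y^-∑ a []       refl = ≋-refl
  y^-∑ a (b ∷ es) e≡   = ≋-trans (y^-∑ (a + b) es e≡) (foldl-cong es y^a+b≋)
    where
    y^a+b≋ : y^ (a + b) ≋ y^ a ⊛ y^ b
    y^a+b≋ = ≋-trans (≋-reflexive (cong q^_ (ℕ.*-distribˡ-+ d a b))) (q^-+ (d * a) (d * b))
    foldl-cong : ∀ {F G} es → F ≋ G → foldl (λ F b → F ⊛ y^ b) F es ≋ foldl (λ F b → F ⊛ y^ b) G es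
    foldl-cong []       F≋G = F≋G
    foldl-cong (b ∷ es) F≋G = foldl-cong es (⊛-cong F≋G ≋-refl)

  y^0≋𝟙 : y^ 0 ≋ 𝟙
  y^0≋𝟙 = ≋-reflexive (cong q^_ (ℕ.*-zeroʳ d))

  1-y^-∑ : ∀ {e} a es → e ≡ foldl _+_ a es → 1-y^ e ≋ 𝟙 ⊕ ⊝ foldl (λ F b → F ⊛ y^ b) (y^ a) es
  1-y^-∑ a es e≡ = ⊕-cong (≋-refl {𝟙}) (⊝-cong (y^-∑ a es e≡))

  poch-shift : ∀ a k → poch a (suc k) ≋ 1-y^ suc a ⊛ poch (suc a) k
  poch-shift a zero    = ≋-trans (⊛-comm 𝟙 _) (⊛-cong (≋-reflexive (cong 1-y^_ (ℕ.+-comm a 1))) ≋-refl)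
  poch-shift a (suc k) = ≋-trans (⊛-cong (poch-shift a k) (≋-reflexive (cong 1-y^_ (ℕ.+-suc a (suc k)))))
                                 (⊛-assoc (1-y^ suc a) (poch (suc a) k) _)

  poch-cong : ∀ {a b} k → a ≡ b → poch a k ≋ poch b k
  poch-cong k refl = ≋-refl

  const-suc : ∀ j → const (+ suc j) ≋ const (+ j) ⊕ 𝟙
  const-suc j zero    = cong +_ (ℕ.+-comm 1 j)
  const-suc j (suc n) = refl

  1- : ∀ {k} → Polynomial k → Polynomial k
  1- p = con 1ℤ :+ :- p

  odd⁺-poly odd⁻-poly : ∀ {k} → Polynomial k → Polynomial k
  odd⁺-poly J = J :+ J :+ con 1ℤ
  odd⁻-poly J = J :+ J :+ :- con 1ℤ

  difference-poly : ∀ {k} (J s W⁺ W⁺′ Y W W′ : Polynomial k) → Polynomial k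
  difference-poly J s W⁺ W⁺′ Y W W′ = odd⁺-poly J :* s :* (W⁺ :* W⁺′) :+ :- (1- Y :^ 3 :* (odd⁺-poly J :* s :* (W :* W′)))

  certificate⁰-poly : ∀ {k} (s P J : Polynomial k) → Polynomial k
  certificate⁰-poly s P J = :- (s :* P :* odd⁺-poly J)

  certificate⁺-poly : ∀ {k} (s Y J P P′ Yj Yn P″ : Polynomial k) → Polynomial k
  certificate⁺-poly s Y J P P′ Yj Yn P″ = :- (s :* Y :* P :* (odd⁺-poly J :* P′ :+ odd⁻-poly J :* (Yj :+ :- Yn) :* P″))

  -- atoms⁰ j and atoms⁺ j k list the series occurring in `telescoping j 0` and `telescoping j (suc k)`
  -- below, ordered so that evaluating difference⁰/telescoped⁰ (resp. difference⁺/telescoped⁺) at them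
  -- gives the two sides of these identities definitionally.
  atoms⁰ : ℕ → Vec Series 13
  atoms⁰ j =
    const (+ j) ∷ signedTri j ∷ poch 1 j ∷ poch (suc (j + 1 + j)) 1 ∷ y^ suc (j + 0) ∷ poch 0 j ∷ poch (suc (j + 0 + j)) 0 ∷
    y^ suc j ∷ poch 0 (suc j) ∷ const (+ suc j) ∷ y^ 1 ∷ poch (j + 0 + j) 1 ∷ y^ j ∷ []

  difference⁰ telescoped⁰ : Polynomial 13
  difference⁰ = difference-poly (var (# 0)) (var (# 1)) (var (# 2)) (var (# 3)) (var (# 4)) (var (# 5)) (var (# 6))
  telescoped⁰ =
    certificate⁰-poly (:- (var (# 7) :* var (# 1))) (var (# 8)) (var (# 9)) :+
    :- certificate⁺-poly (var (# 1)) (var (# 10)) (var (# 0)) (var (# 2)) (var (# 11)) (var (# 12)) (var (# 4)) (var (# 6))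

  atoms⁺ : ℕ → ℕ → Vec Series 17
  atoms⁺ j k =
    const (+ j) ∷ signedTri j ∷ poch (suc (suc k)) j ∷ poch (suc (j + suc (suc k) + j)) (suc (suc k)) ∷
    y^ suc (j + suc k) ∷ poch (suc k) j ∷ poch (suc (j + suc k + j)) (suc k) ∷
    y^ suc j ∷ y^ suc k ∷ poch (suc k) (suc j) ∷ const (+ suc j) ∷ poch (suc j + k + suc j) (suc k) ∷
    y^ suc (suc j + k) ∷ poch (suc (suc j + k + suc j)) k ∷
    y^ suc (suc k) ∷ poch (j + suc k + j) (suc (suc k)) ∷ y^ j ∷ []

  difference⁺ telescoped⁺ : Polynomial 17
  difference⁺ = difference-poly (var (# 0)) (var (# 1)) (var (# 2)) (var (# 3)) (var (# 4)) (var (# 5)) (var (# 6))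
  telescoped⁺ =
    certificate⁺-poly (:- (var (# 7) :* var (# 1))) (var (# 8)) (var (# 10)) (var (# 9)) (var (# 11)) (var (# 7)) (var (# 12)) (var (# 13)) :+
    :- certificate⁺-poly (var (# 1)) (var (# 14)) (var (# 0)) (var (# 2)) (var (# 15)) (var (# 16)) (var (# 4)) (var (# 6))

  private
    1+m+j≡j+m+1 : ∀ j m → suc m + j ≡ j + m + 1
    1+m+j≡j+m+1 = ℕ-Solver.solve-∀
    1+m≡m+1 : ∀ m → suc m ≡ m + 1
    1+m≡m+1 = ℕ-Solver.solve-∀
    m+1+j≡j+m+1 : ∀ j m → m + suc j ≡ j + m + 1
    m+1+j≡j+m+1 = ℕ-Solver.solve-∀
    1+j+m≡j+m+1 : ∀ j m → suc (j + m) ≡ j + m + 1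
    1+j+m≡j+m+1 = ℕ-Solver.solve-∀
    1+[j+1+m+j]≡2+[j+m+j] : ∀ j m → suc (j + suc m + j) ≡ suc (suc (j + m + j))
    1+[j+1+m+j]≡2+[j+m+j] = ℕ-Solver.solve-∀
    1+[j+1+m+j]+m≡j+j+m+m+1+1 : ∀ j m → suc (j + suc m + j) + m ≡ j + j + m + m + 1 + 1
    1+[j+1+m+j]+m≡j+j+m+m+1+1 = ℕ-Solver.solve-∀
    1+[j+1+m+j]+1+m≡j+j+m+m+1+1+1 : ∀ j m → suc (j + suc m + j) + suc m ≡ j + j + m + m + 1 + 1 + 1
    1+[j+1+m+j]+1+m≡j+j+m+m+1+1+1 = ℕ-Solver.solve-∀
    1+[j+m+j]≡j+j+m+1 : ∀ j m → suc (j + m + j) ≡ j + j + m + 1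
    1+[j+m+j]≡j+j+m+1 = ℕ-Solver.solve-∀
    2+[j+m+j]≡j+j+m+1+1 : ∀ j m → suc (suc (j + m + j)) ≡ j + j + m + 1 + 1
    2+[j+m+j]≡j+j+m+1+1 = ℕ-Solver.solve-∀
    1+j+k+1+j≡1+[j+1+k+j] : ∀ j k → suc j + k + suc j ≡ suc (j + suc k + j)
    1+j+k+1+j≡1+[j+1+k+j] = ℕ-Solver.solve-∀
    1+[1+j+k]≡j+1+k+1 : ∀ j k → suc (suc j + k) ≡ j + suc k + 1
    1+[1+j+k]≡j+1+k+1 = ℕ-Solver.solve-∀
    1+[j+1+j]+1≡j+j+1+1+1 : ∀ j → suc (j + 1 + j) + 1 ≡ j + j + 1 + 1 + 1
    1+[j+1+j]+1≡j+j+1+1+1 = ℕ-Solver.solve-∀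
    1+[j+0]≡j+1 : ∀ j → suc (j + 0) ≡ j + 1
    1+[j+0]≡j+1 = ℕ-Solver.solve-∀
    j+0+j+1≡j+j+1 : ∀ j → j + 0 + j + 1 ≡ j + j + 1
    j+0+j+1≡j+j+1 = ℕ-Solver.solve-∀

  -- In each case the products poch a k are split off the common cores poch (m+1) (j-1) and
  -- poch (2j+m+2) (m-1) (when these exist) and every power of y is written in y^1, y^j, y^m;
  -- the identity then holds as a polynomial identity in these atoms.
  telescoping-zero-zero : difference 0 0 ≋ certificate 1 0 ⊕ ⊝ certificate 0 1
  telescoping-zero-zero = by-substitution difference⁰ telescoped⁰ qs σ atoms≋ ≋-refl
    where
    σ : Vec Series 3
    σ = signedTri 0 ∷ const (+ 0) ∷ y^ 1 ∷ []
    s J x : Polynomial 3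
    s = var (# 0); J = var (# 1); x = var (# 2)
    qs : Vec (Polynomial 3) 13
    qs = J ∷ s ∷ con 1ℤ ∷ con 1ℤ :* 1- (x :* x :* x) ∷ x ∷ con 1ℤ ∷ con 1ℤ ∷
         x ∷ con 1ℤ :* 1- x ∷ J :+ con 1ℤ ∷ x ∷ con 1ℤ :* 1- x ∷ con 1ℤ ∷ []
    atoms≋ : Pointwise _≋_ (atoms⁰ 0) (map (λ q → ⟦ q ⟧ σ) qs)
    atoms≋ =
      ≋-refl ∷ ≋-refl ∷ ≋-refl ∷ ⊛-cong ≋-refl (1-y^-∑ 1 (1 ∷ 1 ∷ []) refl) ∷ ≋-refl ∷ ≋-refl ∷ ≋-refl ∷
      ≋-refl ∷ ≋-refl ∷ const-suc 0 ∷ ≋-refl ∷ ≋-refl ∷ y^0≋𝟙 ∷ []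

  telescoping-zero-suc : ∀ k → difference 0 (suc k) ≋ certificate 1 (suc k) ⊕ ⊝ certificate 0 (suc (suc k))
  telescoping-zero-suc k = by-substitution difference⁺ telescoped⁺ qs σ atoms≋ ≋-refl
    where
    m : ℕ
    m = suc k
    σ : Vec Series 5
    σ = signedTri 0 ∷ const (+ 0) ∷ y^ m ∷ y^ 1 ∷ poch (suc (suc (0 + m + 0))) k ∷ []
    s J y x W : Polynomial 5
    s = var (# 0); J = var (# 1); y = var (# 2); x = var (# 3); W = var (# 4)
    qs : Vec (Polynomial 5) 17
    qs = J ∷ s ∷ con 1ℤ ∷ W :* 1- (y :* y :* x :* x) :* 1- (y :* y :* x :* x :* x) ∷
         y :* x ∷ con 1ℤ ∷ 1- (y :* x :* x) :* W ∷
         x ∷ y ∷ con 1ℤ :* 1- (y :* x) ∷ J :+ con 1ℤ ∷ 1- (y :* x :* x) :* W ∷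
         y :* x ∷ W ∷
         y :* x ∷ 1- (y :* x) :* (1- (y :* x :* x) :* W) ∷ con 1ℤ ∷ []
    upper : poch (suc (0 + m + 0)) m ≋ (𝟙 ⊕ ⊝ (y^ m ⊛ y^ 1 ⊛ y^ 1)) ⊛ poch (suc (suc (0 + m + 0))) k
    upper = ≋-trans (poch-shift (suc (0 + m + 0)) k) (⊛-cong (1-y^-∑ m (1 ∷ 1 ∷ []) (2+[j+m+j]≡j+j+m+1+1 0 m)) ≋-refl)
    atoms≋ : Pointwise _≋_ (atoms⁺ 0 k) (map (λ q → ⟦ q ⟧ σ) qs)
    atoms≋ =
      ≋-refl ∷ ≋-refl ∷ ≋-refl ∷
      ⊛-cong (⊛-cong (poch-cong k (1+[j+1+m+j]≡2+[j+m+j] 0 m))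
                     (1-y^-∑ m (m ∷ 1 ∷ 1 ∷ []) (1+[j+1+m+j]+m≡j+j+m+m+1+1 0 m)))
             (1-y^-∑ m (m ∷ 1 ∷ 1 ∷ 1 ∷ []) (1+[j+1+m+j]+1+m≡j+j+m+m+1+1+1 0 m)) ∷
      y^-∑ m (1 ∷ []) (1+m≡m+1 m) ∷ ≋-refl ∷ upper ∷
      ≋-refl ∷ ≋-refl ∷ ⊛-cong ≋-refl (1-y^-∑ m (1 ∷ []) refl) ∷ const-suc 0 ∷
      ≋-trans (poch-cong m (1+j+k+1+j≡1+[j+1+k+j] 0 k)) upper ∷
      y^-∑ m (1 ∷ []) (1+[1+j+k]≡j+1+k+1 0 k) ∷ poch-cong k (cong suc (1+j+k+1+j≡1+[j+1+k+j] 0 k)) ∷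
      y^-∑ m (1 ∷ []) (1+m≡m+1 m) ∷
      ≋-trans (poch-shift (0 + m + 0) m) (⊛-cong (1-y^-∑ m (1 ∷ []) (1+[j+m+j]≡j+j+m+1 0 m)) upper) ∷
      y^0≋𝟙 ∷ []

  telescoping-suc-zero : ∀ i → difference (suc i) 0 ≋ certificate (suc (suc i)) 0 ⊕ ⊝ certificate (suc i) 1
  telescoping-suc-zero i = by-substitution difference⁰ telescoped⁰ qs σ atoms≋ ≋-refl
    where
    j : ℕ
    j = suc i
    σ : Vec Series 5
    σ = signedTri j ∷ const (+ j) ∷ y^ j ∷ y^ 1 ∷ poch 1 i ∷ []
    s J b x V : Polynomial 5
    s = var (# 0); J = var (# 1); b = var (# 2); x = var (# 3); V = var (# 4)
    qs : Vec (Polynomial 5) 13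
    qs = J ∷ s ∷ V :* 1- (b :* x) ∷ con 1ℤ :* 1- (b :* b :* x :* x :* x) ∷ b :* x ∷ 1- x :* V ∷ con 1ℤ ∷
         b :* x ∷ 1- x :* V :* 1- (b :* x) ∷ J :+ con 1ℤ ∷ x ∷ con 1ℤ :* 1- (b :* b :* x) ∷ b ∷ []
    atoms≋ : Pointwise _≋_ (atoms⁰ j) (map (λ q → ⟦ q ⟧ σ) qs)
    atoms≋ =
      ≋-refl ∷ ≋-refl ∷ ⊛-cong ≋-refl (1-y^-∑ j (1 ∷ []) (1+m≡m+1 j)) ∷
      ⊛-cong ≋-refl (1-y^-∑ j (j ∷ 1 ∷ 1 ∷ 1 ∷ []) (1+[j+1+j]+1≡j+j+1+1+1 j)) ∷
      y^-∑ j (1 ∷ []) (1+[j+0]≡j+1 j) ∷ poch-shift 0 i ∷ ≋-refl ∷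
      y^-∑ j (1 ∷ []) (1+m≡m+1 j) ∷ ⊛-cong (poch-shift 0 i) (1-y^-∑ j (1 ∷ []) (1+m≡m+1 j)) ∷ const-suc j ∷ ≋-refl ∷
      ⊛-cong ≋-refl (1-y^-∑ j (j ∷ 1 ∷ []) (j+0+j+1≡j+j+1 j)) ∷ ≋-refl ∷ []

  telescoping-suc-suc : ∀ i k → difference (suc i) (suc k) ≋ certificate (suc (suc i)) (suc k) ⊕ ⊝ certificate (suc i) (suc (suc k))
  telescoping-suc-suc i k = by-substitution difference⁺ telescoped⁺ qs σ atoms≋ ≋-refl
    where
    j m : ℕ
    j = suc i
    m = suc k
    σ : Vec Series 7
    σ = signedTri j ∷ const (+ j) ∷ y^ j ∷ y^ m ∷ y^ 1 ∷ poch (suc m) i ∷ poch (suc (suc (j + m + j))) k ∷ []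
    s J b y x V W : Polynomial 7
    s = var (# 0); J = var (# 1); b = var (# 2); y = var (# 3); x = var (# 4); V = var (# 5); W = var (# 6)
    qs : Vec (Polynomial 7) 17
    qs = J ∷ s ∷ V :* 1- (b :* y :* x) ∷ W :* 1- (b :* b :* y :* y :* x :* x) :* 1- (b :* b :* y :* y :* x :* x :* x) ∷
         b :* y :* x ∷ 1- (y :* x) :* V ∷ 1- (b :* b :* y :* x :* x) :* W ∷
         b :* x ∷ y ∷ 1- (y :* x) :* V :* 1- (b :* y :* x) ∷ J :+ con 1ℤ ∷ 1- (b :* b :* y :* x :* x) :* W ∷
         b :* y :* x ∷ W ∷
         y :* x ∷ 1- (b :* b :* y :* x) :* (1- (b :* b :* y :* x :* x) :* W) ∷ b ∷ []
    lower : poch m j ≋ (𝟙 ⊕ ⊝ (y^ m ⊛ y^ 1)) ⊛ poch (suc m) i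
    lower = ≋-trans (poch-shift m i) (⊛-cong (1-y^-∑ m (1 ∷ []) (1+m≡m+1 m)) ≋-refl)
    upper : poch (suc (j + m + j)) m ≋ (𝟙 ⊕ ⊝ (y^ j ⊛ y^ j ⊛ y^ m ⊛ y^ 1 ⊛ y^ 1)) ⊛ poch (suc (suc (j + m + j))) k
    upper = ≋-trans (poch-shift (suc (j + m + j)) k) (⊛-cong (1-y^-∑ j (j ∷ m ∷ 1 ∷ 1 ∷ []) (2+[j+m+j]≡j+j+m+1+1 j m)) ≋-refl)
    atoms≋ : Pointwise _≋_ (atoms⁺ j k) (map (λ q → ⟦ q ⟧ σ) qs)
    atoms≋ =
      ≋-refl ∷ ≋-refl ∷ ⊛-cong ≋-refl (1-y^-∑ j (m ∷ 1 ∷ []) (1+m+j≡j+m+1 j m)) ∷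
      ⊛-cong (⊛-cong (poch-cong k (1+[j+1+m+j]≡2+[j+m+j] j m))
                     (1-y^-∑ j (j ∷ m ∷ m ∷ 1 ∷ 1 ∷ []) (1+[j+1+m+j]+m≡j+j+m+m+1+1 j m)))
             (1-y^-∑ j (j ∷ m ∷ m ∷ 1 ∷ 1 ∷ 1 ∷ []) (1+[j+1+m+j]+1+m≡j+j+m+m+1+1+1 j m)) ∷
      y^-∑ j (m ∷ 1 ∷ []) (1+j+m≡j+m+1 j m) ∷ lower ∷ upper ∷
      y^-∑ j (1 ∷ []) (1+m≡m+1 j) ∷ ≋-refl ∷
      ⊛-cong lower (1-y^-∑ j (m ∷ 1 ∷ []) (m+1+j≡j+m+1 j m)) ∷ const-suc j ∷
      ≋-trans (poch-cong m (1+j+k+1+j≡1+[j+1+k+j] j k)) upper ∷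
      y^-∑ j (m ∷ 1 ∷ []) (1+[1+j+k]≡j+1+k+1 j k) ∷ poch-cong k (cong suc (1+j+k+1+j≡1+[j+1+k+j] j k)) ∷
      y^-∑ m (1 ∷ []) (1+m≡m+1 m) ∷
      ≋-trans (poch-shift (j + m + j) m) (⊛-cong (1-y^-∑ j (j ∷ m ∷ 1 ∷ []) (1+[j+m+j]≡j+j+m+1 j m)) upper) ∷
      ≋-refl ∷ []

  telescoping : ∀ j m → difference j m ≋ certificate (suc j) m ⊕ ⊝ certificate j (suc m)
  telescoping zero    zero    = telescoping-zero-zero
  telescoping zero    (suc k) = telescoping-zero-suc k
  telescoping (suc i) zero    = telescoping-suc-zero i
  telescoping (suc i) (suc k) = telescoping-suc-suc i k

  certificate-zero-suc : ∀ m → certificate 0 (suc m) ≋ 𝟘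
  certificate-zero-suc m = ≋-trans (by-substitution certificate⁰⁺ (con 0ℤ) qs σ atoms≋ ≋-refl) const0≋𝟘
    where
    certificate⁰⁺ : Polynomial 8
    certificate⁰⁺ = certificate⁺-poly (var (# 0)) (var (# 1)) (var (# 2)) (var (# 3)) (var (# 4)) (var (# 5)) (var (# 6)) (var (# 7))
    σ : Vec Series 2
    σ = y^ suc m ∷ poch (suc (0 + m + 0)) m ∷ []
    qs : Vec (Polynomial 2) 8
    qs = con 1ℤ ∷ var (# 0) ∷ con 0ℤ ∷ con 1ℤ ∷ 1- (var (# 0)) :* var (# 1) ∷ con 1ℤ ∷ var (# 0) ∷ var (# 1) ∷ []
    atoms≋ : Pointwise _≋_ (signedTri 0 ∷ y^ suc m ∷ const (+ 0) ∷ poch (suc m) 0 ∷ poch (0 + m + 0) (suc m) ∷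
                            y^ 0 ∷ y^ suc (0 + m) ∷ poch (suc (0 + m + 0)) m ∷ [])
                           (map (λ q → ⟦ q ⟧ σ) qs)
    atoms≋ =
      ≋-refl ∷ ≋-refl ∷ ≋-refl ∷ ≋-refl ∷
      ≋-trans (poch-shift (0 + m + 0) m) (⊛-cong (≋-reflexive (cong (λ e → 1-y^ suc e) (ℕ.+-identityʳ m))) ≋-refl) ∷
      y^0≋𝟙 ∷ ≋-refl ∷ ≋-refl ∷ []
    const0≋𝟘 : const 0ℤ ≋ 𝟘
    const0≋𝟘 zero    = refl
    const0≋𝟘 (suc n) = refl

  jacobiTerm⊛weight-zero : ∀ j → jacobiTerm j ⊛ weight j 0 ≋ ⊝ certificate j 0
  jacobiTerm⊛weight-zero j =
    solve 3 (λ o s P → (o :* s) :* (P :* con 1ℤ) := :- (:- (s :* P :* o))) ≋-refl (odd⁺ j) (signedTri j) (poch 0 j)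

  jacobi : ∀ n → jacobiSum n ≋ poch 0 n ^ 3
  jacobi zero    = solve 0 ((con 0ℤ :+ con 0ℤ :+ con 1ℤ) :* con 1ℤ :* (con 1ℤ :* con 1ℤ) := con 1ℤ :^ 3) ≋-refl
  jacobi (suc n) = begin
    jacobiSum (suc n)
      ≈⟨ ⊕-cong (∑-antidiagonal-cong n (λ j m _ → split j m)) (jacobiTerm⊛weight-zero (suc n)) ⟩
    ∑-antidiagonal n (λ j m → difference j m ⊕ cube-factor j m) ⊕ ⊝ certificate (suc n) 0
      ≈⟨ ⊕-cong (∑-antidiagonal-⊕ n difference cube-factor) ≋-refl ⟩
    ∑-antidiagonal n difference ⊕ ∑-antidiagonal n cube-factor ⊕ ⊝ certificate (suc n) 0
      ≈⟨ ⊕-cong (⊕-cong telescoped factored) ≋-refl ⟩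
    certificate (suc n) 0 ⊕ (1-y^ suc n) ^ 3 ⊛ poch 0 n ^ 3 ⊕ ⊝ certificate (suc n) 0
      ≈⟨ solve 3 (λ E F P → E :+ F :^ 3 :* P :^ 3 :+ :- E := (P :* F) :^ 3) ≋-refl
                 (certificate (suc n) 0) (1-y^ suc n) (poch 0 n) ⟩
    poch 0 (suc n) ^ 3 ∎
    where
    open import Relation.Binary.Reasoning.Setoid ≋-setoid
    cube-factor : ℕ → ℕ → Series
    cube-factor j m = (1-y^ suc (j + m)) ^ 3 ⊛ (jacobiTerm j ⊛ weight j m)
    split : ∀ j m → jacobiTerm j ⊛ weight j (suc m) ≋ difference j m ⊕ cube-factor j m
    split j m = solve 2 (λ A B → A := A :+ :- B :+ B) ≋-refl (jacobiTerm j ⊛ weight j (suc m)) (cube-factor j m)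
    telescoped : ∑-antidiagonal n difference ≋ certificate (suc n) 0
    telescoped = ≋-trans (∑-antidiagonal-cong n (λ j m _ → telescoping j m))
                 (≋-trans (∑-antidiagonal-telescope n certificate)
                          (≋-trans (⊕-cong (≋-refl {certificate (suc n) 0}) (⊝-cong (certificate-zero-suc n)))
                                   (⊕-identityʳ (certificate (suc n) 0))))
    factored : ∑-antidiagonal n cube-factor ≋ (1-y^ suc n) ^ 3 ⊛ poch 0 n ^ 3
    factored = ≋-trans (∑-antidiagonal-cong n (λ j m j+m≡n → ⊛-cong (≋-reflexive (cong (λ e → (1-y^ suc e) ^ 3) j+m≡n)) ≋-refl))
                       (≋-trans (∑-antidiagonal-⊛ n ((1-y^ suc n) ^ 3) (λ j m → jacobiTerm j ⊛ weight j m))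
                                (⊛-cong ≋-refl (jacobi n)))

  signedTri-± : ∀ j → signedTri j ≋ y^ (tri j) ⊎ signedTri j ≋ ⊝ y^ (tri j)
  signedTri-± zero    = inj₁ (≋-sym y^0≋𝟙)
  signedTri-± (suc j) with signedTri-± j
  ... | inj₁ s≋y  = inj₂ (⊝-cong (≋-trans (⊛-cong ≋-refl s≋y) (≋-sym (y^-∑ (suc j) (tri j ∷ []) refl))))
  ... | inj₂ s≋-y = inj₁ (≋-trans (⊝-cong (⊛-cong ≋-refl s≋-y))
                         (≋-trans (solve 2 (λ a b → :- (a :* :- b) := a :* b) ≋-refl (y^ suc j) (y^ tri j))
                                  (≋-sym (y^-∑ (suc j) (tri j ∷ []) refl))))

  poch≋[<]𝟙 : ∀ a k → poch a k ≋[< d * suc a ] 𝟙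
  poch≋[<]𝟙 a zero    = λ _ _ → refl
  poch≋[<]𝟙 a (suc k) = ⊛-≋[<]𝟙 (poch≋[<]𝟙 a k)
    (≋[<]-weaken (ℕ.*-monoʳ-≤ d (ℕ.m<m+n a (s≤s z≤n))) (1-q^≋[<]𝟙 (d * (a + suc k))))

  weight≋[<]𝟙 : ∀ j m → weight j m ≋[< d * suc m ] 𝟙
  weight≋[<]𝟙 j m = ⊛-≋[<]𝟙 (poch≋[<]𝟙 m j) (≋[<]-weaken (ℕ.*-monoʳ-≤ d (s≤s m≤)) (poch≋[<]𝟙 (suc (j + m + j)) m))
    where m≤ : m ≤ suc (j + m + j)
          m≤ = ℕ.≤-trans (ℕ.m≤n+m m j) (ℕ.≤-trans (ℕ.m≤m+n (j + m) j) (ℕ.n≤1+n _))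

  private
    remainder< : ∀ {j m e r} → d * j ≤ e → e + r < d * suc (j + m) → r < d * suc m
    remainder< {j} {m} {e} {r} dj≤e e+r< = ℕ.+-cancelˡ-< e r (d * suc m) (begin-strict
      e + r               <⟨ e+r< ⟩
      d * suc (j + m)     ≡⟨ cong (d *_) (ℕ.+-suc j m) ⟨
      d * (j + suc m)     ≡⟨ ℕ.*-distribˡ-+ d j (suc m) ⟩
      d * j + d * suc m   ≤⟨ ℕ.+-monoˡ-≤ (d * suc m) dj≤e ⟩
      e + d * suc m       ∎)
      where open ℕ.≤-Reasoning

  -- weight j m ≡ 1 modulo y^(m+1) and tri j ≥ j, so below y^(j+m+1) only the term y^(tri j) survives.
  y^tri⊛weight-vanishes : ∀ j m t → t < d * suc (j + m) → t ≢ d * tri j → (y^ tri j ⊛ weight j m) t ≡ 0ℤ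
  y^tri⊛weight-vanishes j m t t< t≢e with t ℕ.<? d * tri j
  ... | yes t<e = trans (q^-⊛ (d * tri j) (weight j m) t) (shift-below (d * tri j) (weight j m) t t<e)
  ... | no  t≮e with ℕ.m≤n⇒∃[o]m+o≡n (ℕ.≮⇒≥ t≮e)
  ...   | zero  , refl = contradiction (ℕ.+-identityʳ (d * tri j)) t≢e
  ...   | suc r , refl = begin
    (q^ (d * tri j) ⊛ weight j m) (d * tri j + suc r) ≡⟨ q^-⊛ (d * tri j) (weight j m) _ ⟩
    shift (d * tri j) (weight j m) (d * tri j + suc r) ≡⟨ shift-above (d * tri j) (weight j m) (suc r) ⟩
    weight j m (suc r)                                 ≡⟨ weight≋[<]𝟙 j m (suc r) (remainder< (ℕ.*-monoʳ-≤ d (j≤tri j)) t<) ⟩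
    0ℤ                                                 ∎
    where open ≡-Reasoning

  odd⁺≋const : ∀ j → odd⁺ j ≋ const (+ j ℤ.+ + j ℤ.+ 1ℤ)
  odd⁺≋const j zero    = refl
  odd⁺≋const j (suc n) = refl

  jacobiTerm⊛weight-vanishes : ∀ j m t → t < d * suc (j + m) → t ≢ d * tri j → (jacobiTerm j ⊛ weight j m) t ≡ 0ℤ
  jacobiTerm⊛weight-vanishes j m t t< t≢ = begin
    (odd⁺ j ⊛ signedTri j ⊛ weight j m) t  ≡⟨ ⊛-assoc (odd⁺ j) (signedTri j) (weight j m) t ⟩
    (odd⁺ j ⊛ (signedTri j ⊛ weight j m)) t ≡⟨ ⊛-cong (odd⁺≋const j) ≋-refl t ⟩
    (const c ⊛ (signedTri j ⊛ weight j m)) t ≡⟨ const-⊛ c (signedTri j ⊛ weight j m) t ⟩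
    c ℤ.* (signedTri j ⊛ weight j m) t      ≡⟨ cong (c ℤ.*_) (signed (signedTri-± j)) ⟩
    c ℤ.* 0ℤ                                ≡⟨ ℤ.*-zeroʳ c ⟩
    0ℤ                                      ∎
    where
    open ≡-Reasoning
    c = + j ℤ.+ + j ℤ.+ 1ℤ
    signed : signedTri j ≋ y^ (tri j) ⊎ signedTri j ≋ ⊝ y^ (tri j) → (signedTri j ⊛ weight j m) t ≡ 0ℤ
    signed (inj₁ s≋y)  = trans (⊛-cong s≋y ≋-refl t) (y^tri⊛weight-vanishes j m t t< t≢)
    signed (inj₂ s≋-y) = begin
      (signedTri j ⊛ weight j m) t       ≡⟨ ⊛-cong s≋-y ≋-refl t ⟩
      (⊝ y^ tri j ⊛ weight j m) t        ≡⟨ solve 2 (λ a b → :- a :* b := :- (a :* b)) ≋-refl (y^ tri j) (weight j m) t ⟩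
      ℤ.- (y^ tri j ⊛ weight j m) t      ≡⟨ cong ℤ.-_ (y^tri⊛weight-vanishes j m t t< t≢) ⟩
      0ℤ                                 ∎

  jacobi-coefficient-vanishes : ∀ n t → t < d * suc n → (∀ j → t ≢ d * tri j) → (poch 0 n ^ 3) t ≡ 0ℤ
  jacobi-coefficient-vanishes n t t< t≢ = trans (sym (jacobi n t))
    (∑-antidiagonal-vanishes n (λ j m → jacobiTerm j ⊛ weight j m) t
      (λ j m j+m≡n → jacobiTerm⊛weight-vanishes j m t (subst (λ k → t < d * suc k) (sym j+m≡n) t<) (t≢ j)))


module Multichoose where

  open import Data.Nat.Base
  open import Data.Nat.Properties
  open import Data.Nat.Combinatorics using (_C_; nCk+nC[k+1]≡[n+1]C[k+1]; nCk≡nC[n∸k]; nC1≡n)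
  open import Data.Nat.Combinatorics.Specification using (k>n⇒nCk≡0)
  open import Data.Nat.Divisibility using (_∣_; divides; ∣m+n∣m⇒∣n; ∣-refl)
  open import Data.Nat.Primality using (Prime; euclidsLemma)
  import Data.Nat.Tactic.RingSolver as ℕ-Solver
  open import Data.Sum.Base using (inj₁; inj₂)
  open import Relation.Binary.PropositionalEquality
  open import Relation.Nullary.Negation using (¬_; contradiction)
  open import Defs using (multichoose)

  multichoose-zero-suc : ∀ j → multichoose 0 (suc j) ≡ 0
  multichoose-zero-suc j = k>n⇒nCk≡0 (n<1+n j)

  multichoose-pascal : ∀ c j → multichoose (suc c) (suc j) ≡ multichoose (suc c) j + multichoose c (suc j)
  multichoose-pascal c j rewrite +-suc c j = sym (nCk+nC[k+1]≡[n+1]C[k+1] (c + j) j)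

  [1+k]*[1+n]C[1+k]≡[1+n]*nCk : ∀ n k → suc k * (suc n C suc k) ≡ suc n * (n C k)
  [1+k]*[1+n]C[1+k]≡[1+n]*nCk zero    zero    = refl
  [1+k]*[1+n]C[1+k]≡[1+n]*nCk zero    (suc k) = begin
    suc (suc k) * (1 C suc (suc k))   ≡⟨ cong (suc (suc k) *_) (k>n⇒nCk≡0 {1} {suc (suc k)} (s≤s (s≤s z≤n))) ⟩
    suc (suc k) * 0                   ≡⟨ *-zeroʳ (suc (suc k)) ⟩
    0                                 ≡⟨ cong (1 *_) (k>n⇒nCk≡0 {0} {suc k} (s≤s z≤n)) ⟨
    1 * (0 C suc k)                   ∎
    where open ≡-Reasoning
  [1+k]*[1+n]C[1+k]≡[1+n]*nCk (suc n) zero    = trans (*-identityˡ _) (trans (nC1≡n (suc (suc n))) (sym (*-identityʳ (suc (suc n)))))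
  [1+k]*[1+n]C[1+k]≡[1+n]*nCk (suc n) (suc k) = begin
    suc (suc k) * (suc (suc n) C suc (suc k))        ≡⟨ cong (suc (suc k) *_) (nCk+nC[k+1]≡[n+1]C[k+1] (suc n) (suc k)) ⟨
    suc (suc k) * (A + B)                            ≡⟨ distrib (suc k) A B ⟩
    A + suc k * A + suc (suc k) * B
      ≡⟨ cong₂ (λ u v → A + u + v) ([1+k]*[1+n]C[1+k]≡[1+n]*nCk n k) ([1+k]*[1+n]C[1+k]≡[1+n]*nCk n (suc k)) ⟩
    A + suc n * (n C k) + suc n * (n C suc k)        ≡⟨ factor (suc n) A (n C k) (n C suc k) ⟩
    A + suc n * (n C k + n C suc k)                  ≡⟨ cong (λ u → A + suc n * u) (nCk+nC[k+1]≡[n+1]C[k+1] n k) ⟩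
    suc (suc n) * A                                  ∎
    where
    open ≡-Reasoning
    A = suc n C suc k
    B = suc n C suc (suc k)
    distrib : ∀ k A B → suc k * (A + B) ≡ A + k * A + suc k * B
    distrib = ℕ-Solver.solve-∀
    factor : ∀ n A a b → A + n * a + n * b ≡ A + n * (a + b)
    factor = ℕ-Solver.solve-∀

  -- p · C(p+j, p) = (p+j) · C(p+j-1, j), and p ∤ p + j.
  prime∣multichoose : ∀ {p} j → Prime p → ¬ p ∣ j → p ∣ multichoose p j
  prime∣multichoose {zero}    j () _
  prime∣multichoose {suc p-1} j p-prime p∤j with euclidsLemma (suc (p-1 + j)) ((p-1 + j) C j) p-prime p∣[p+j]*mc
    where
    p∣[p+j]*mc : suc p-1 ∣ suc (p-1 + j) * ((p-1 + j) C j)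
    p∣[p+j]*mc = divides (suc (p-1 + j) C suc p-1) (begin
      suc (p-1 + j) * ((p-1 + j) C j)      ≡⟨ cong (suc (p-1 + j) *_) (nCk≡nC[n∸k] (m≤n+m j p-1)) ⟩
      suc (p-1 + j) * ((p-1 + j) C ((p-1 + j) ∸ j)) ≡⟨ cong (λ k → suc (p-1 + j) * ((p-1 + j) C k)) (m+n∸n≡m p-1 j) ⟩
      suc (p-1 + j) * ((p-1 + j) C p-1)    ≡⟨ [1+k]*[1+n]C[1+k]≡[1+n]*nCk (p-1 + j) p-1 ⟨
      suc p-1 * (suc (p-1 + j) C suc p-1)  ≡⟨ *-comm (suc p-1) _ ⟩
      (suc (p-1 + j) C suc p-1) * suc p-1  ∎)
      where open ≡-Reasoning
  ... | inj₁ p∣p+j = contradiction (∣m+n∣m⇒∣n p∣p+j ∣-refl) p∤j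
  ... | inj₂ p∣mc  = p∣mc

module AddingParts where

  open import Algebra.Properties.CommutativeSemigroup using (interchange)
  open import Data.Bool.Base using (true; false; if_then_else_; T)
  open import Data.Nat.Base
  open import Data.Nat.Properties
  open import Data.Nat.Divisibility using (_∣_; ∣n⇒∣m*n; ∣m⇒∣m*n; ∣m∣n⇒∣m+n; _∣0)
  open import Data.Nat.Primality using (Prime)
  open import Data.Sum.Base using (inj₁; inj₂)
  open import Data.Unit.Base using (tt)
  open import Relation.Binary.PropositionalEquality
  open import Relation.Nullary.Decidable using (yes; no)
  open import Relation.Nullary.Negation using (¬_; contradiction)
  open import Defs using (multichoose; sumTo)
  open Multichoose

  sumTo-suc : ∀ n f → sumTo (suc n) f ≡ f 0 + sumTo n (λ j → f (suc j))
  sumTo-suc zero    f = refl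
  sumTo-suc (suc n) f = trans (cong (_+ f (suc (suc n))) (sumTo-suc n f)) (+-assoc (f 0) _ _)

  sumTo-cong : ∀ n {f g} → (∀ j → f j ≡ g j) → sumTo n f ≡ sumTo n g
  sumTo-cong zero    f≡g = f≡g 0
  sumTo-cong (suc n) f≡g = cong₂ _+_ (sumTo-cong n f≡g) (f≡g (suc n))

  sumTo-+ : ∀ n f g → sumTo n (λ j → f j + g j) ≡ sumTo n f + sumTo n g
  sumTo-+ zero    f g = refl
  sumTo-+ (suc n) f g = trans (cong (_+ (f (suc n) + g (suc n))) (sumTo-+ n f g))
                              (interchange +-commutativeSemigroup (sumTo n f) (sumTo n g) _ _)

  sumTo-truncate : ∀ {m} n f → m ≤ n → (∀ j → m < j → f j ≡ 0) → sumTo n f ≡ sumTo m f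
  sumTo-truncate zero    f z≤n _   = refl
  sumTo-truncate (suc n) f m≤1+n f≡0 with m≤n⇒m<n∨m≡n m≤1+n
  ... | inj₁ (s≤s m≤n) = trans (cong₂ _+_ (sumTo-truncate n f m≤n f≡0) (f≡0 (suc n) (s≤s m≤n))) (+-identityʳ _)
  ... | inj₂ refl      = refl

  ∣-sumTo : ∀ {p} n f → (∀ j → p ∣ f j) → p ∣ sumTo n f
  ∣-sumTo zero    f p∣f = p∣f 0
  ∣-sumTo (suc n) f p∣f = ∣m∣n⇒∣m+n (∣-sumTo n f p∣f) (p∣f (suc n))

  -- addParts d c Y adds parts of size d in c colours to the partitions counted by Y;
  -- parts r s (suc m) is addParts (suc m) (colors r s (suc m)) (parts r s m) by definition.
  addPartsTerm : ℕ → ℕ → (ℕ → ℕ) → ℕ → ℕ → ℕ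
  addPartsTerm d c Y n j = if j * d ≤ᵇ n then multichoose c j * Y (n ∸ j * d) else 0

  addParts : ℕ → ℕ → (ℕ → ℕ) → ℕ → ℕ
  addParts d c Y n = sumTo n (addPartsTerm d c Y n)

  addPartsTerm-≤ : ∀ d c Y n j → j * d ≤ n → addPartsTerm d c Y n j ≡ multichoose c j * Y (n ∸ j * d)
  addPartsTerm-≤ d c Y n j jd≤n with j * d ≤ᵇ n in eq
  ... | true  = refl
  ... | false = contradiction (subst T eq (≤⇒≤ᵇ jd≤n)) λ ()

  addPartsTerm-> : ∀ d c Y n j → n < j * d → addPartsTerm d c Y n j ≡ 0
  addPartsTerm-> d c Y n j n<jd with j * d ≤ᵇ n in eq
  ... | true  = contradiction (≤ᵇ⇒≤ (j * d) n (subst T (sym eq) tt)) (<⇒≱ n<jd)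
  ... | false = refl

  addParts-below : ∀ d c Y n → n < suc d → addParts (suc d) c Y n ≡ Y n
  addParts-below d c Y n n<d = trans (sumTo-truncate n _ z≤n vanish) (*-identityˡ (Y n))
    where
    vanish : ∀ j → 0 < j → addPartsTerm (suc d) c Y n j ≡ 0
    vanish (suc j) _ = addPartsTerm-> (suc d) c Y n (suc j) (<-≤-trans n<d (m≤n*m (suc d) (suc j)))

  addParts-zero : ∀ d Y n → addParts (suc d) 0 Y n ≡ Y n
  addParts-zero d Y n = trans (sumTo-truncate n _ z≤n vanish) (*-identityˡ (Y n))
    where
    vanish : ∀ j → 0 < j → addPartsTerm (suc d) 0 Y n j ≡ 0
    vanish (suc j) _ with suc j * suc d ≤ᵇ n
    ... | true  = cong (_* Y (n ∸ suc j * suc d)) (multichoose-zero-suc j)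
    ... | false = refl

  addParts-pascal : ∀ d c Y n → addParts (suc d) (suc c) Y (suc d + n) ≡ addParts (suc d) c Y (suc d + n) + addParts (suc d) (suc c) Y n
  addParts-pascal d c Y n = begin
    sumTo (suc (d + n)) (t (suc c) N)
      ≡⟨ sumTo-suc (d + n) (t (suc c) N) ⟩
    t (suc c) N 0 + sumTo (d + n) (λ j → t (suc c) N (suc j))
      ≡⟨ cong (t c N 0 +_) (trans (sumTo-cong (d + n) split) (sumTo-+ (d + n) (t (suc c) n) (λ j → t c N (suc j)))) ⟩
    t c N 0 + (sumTo (d + n) (t (suc c) n) + sumTo (d + n) (λ j → t c N (suc j)))
      ≡⟨ cong (λ a → t c N 0 + (a + sumTo (d + n) (λ j → t c N (suc j))))
              (sumTo-truncate (d + n) (t (suc c) n) (m≤n+m n d)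
                 (λ j n<j → addPartsTerm-> (suc d) (suc c) Y n j (<-≤-trans n<j (m≤m*n j (suc d))))) ⟩
    t c N 0 + (addParts (suc d) (suc c) Y n + sumTo (d + n) (λ j → t c N (suc j)))
      ≡⟨ rotate (t c N 0) _ _ ⟩
    (t c N 0 + sumTo (d + n) (λ j → t c N (suc j))) + addParts (suc d) (suc c) Y n
      ≡⟨ cong (_+ addParts (suc d) (suc c) Y n) (sumTo-suc (d + n) (t c N)) ⟨
    addParts (suc d) c Y N + addParts (suc d) (suc c) Y n ∎
    where
    open ≡-Reasoning
    N = suc d + n
    t : ℕ → ℕ → ℕ → ℕ
    t c = addPartsTerm (suc d) c Y
    rotate : ∀ a b c → a + (b + c) ≡ (a + c) + b
    rotate a b c = trans (cong (a +_) (+-comm b c)) (sym (+-assoc a c b))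
    split : ∀ j → t (suc c) N (suc j) ≡ t (suc c) n j + t c N (suc j)
    split j with j * suc d ≤? n
    ... | yes jd≤n = begin
      t (suc c) N (suc j)                   ≡⟨ addPartsTerm-≤ (suc d) (suc c) Y N (suc j) (+-monoʳ-≤ (suc d) jd≤n) ⟩
      multichoose (suc c) (suc j) * Y (N ∸ (suc d + j * suc d))
        ≡⟨ cong₂ (λ a b → a * Y b) (multichoose-pascal c j) ([m+n]∸[m+o]≡n∸o (suc d) n (j * suc d)) ⟩
      (multichoose (suc c) j + multichoose c (suc j)) * Y (n ∸ j * suc d)
        ≡⟨ *-distribʳ-+ (Y (n ∸ j * suc d)) (multichoose (suc c) j) _ ⟩
      multichoose (suc c) j * Y (n ∸ j * suc d) + multichoose c (suc j) * Y (n ∸ j * suc d)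
        ≡⟨ cong₂ _+_ (addPartsTerm-≤ (suc d) (suc c) Y n j jd≤n)
                     (trans (addPartsTerm-≤ (suc d) c Y N (suc j) (+-monoʳ-≤ (suc d) jd≤n))
                            (cong (λ b → multichoose c (suc j) * Y b) ([m+n]∸[m+o]≡n∸o (suc d) n (j * suc d)))) ⟨
      t (suc c) n j + t c N (suc j)         ∎
    ... | no  jd≰n = trans (addPartsTerm-> (suc d) (suc c) Y N (suc j) (+-monoʳ-< (suc d) n<jd))
                           (sym (cong₂ _+_ (addPartsTerm-> (suc d) (suc c) Y n j n<jd)
                                           (addPartsTerm-> (suc d) c Y N (suc j) (+-monoʳ-< (suc d) n<jd))))
      where n<jd = ≰⇒> jd≰n

  δ₀ : ℕ → ℕ
  δ₀ zero    = 1
  δ₀ (suc _) = 0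

  addParts-prime-sparse : ∀ {p} d n → Prime p → ¬ p ∣ n → p ∣ addParts (suc d) p δ₀ n
  addParts-prime-sparse {p} d n p-prime p∤n = ∣-sumTo n (addPartsTerm (suc d) p δ₀ n) p∣term
    where
    p∣term : ∀ j → p ∣ addPartsTerm (suc d) p δ₀ n j
    p∣term j with j * suc d ≤? n
    ... | no  jd≰n = subst (p ∣_) (sym (addPartsTerm-> (suc d) p δ₀ n j (≰⇒> jd≰n))) (p ∣0)
    ... | yes jd≤n = subst (p ∣_) (sym (addPartsTerm-≤ (suc d) p δ₀ n j jd≤n)) (p∣mc*δ₀ (n ∸ j * suc d) refl)
      where
      p∣mc*δ₀ : ∀ k → n ∸ j * suc d ≡ k → p ∣ multichoose p j * δ₀ k
      p∣mc*δ₀ (suc k) _       = ∣n⇒∣m*n (multichoose p j) (p ∣0)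
      p∣mc*δ₀ zero    n∸jd≡0 = ∣m⇒∣m*n 1 (prime∣multichoose j p-prime p∤j)
        where
        p∤j : ¬ p ∣ j
        p∤j p∣j = p∤n (subst (p ∣_) (≤-antisym jd≤n (m∸n≡0⇒m≤n n∸jd≡0)) (∣m⇒∣m*n (suc d) p∣j))

module Sparsity where

  open PowerSeries
  open import Data.Integer.Base using (+_; 0ℤ; _*_)
  open import Data.Integer.Divisibility.Signed using (_∣_; ∣m⇒∣m*n; ∣n⇒∣m*n; divides)
  open import Data.Nat.Base using (ℕ; zero; suc)
  import Data.Nat.Base as ℕ
  open import Data.Nat.Divisibility as ℕ using (_∣?_; ∣m∣n⇒∣m+n; _∣0)
  open import Relation.Binary.PropositionalEquality using (_≡_; refl; subst)
  open import Relation.Nullary.Decidable using (yes; no)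
  open import Relation.Nullary.Negation using (¬_; contradiction)

  Sparse : ℕ → Series → Set
  Sparse p F = ∀ n → ¬ p ℕ.∣ n → + p ∣ F n

  Sparse-≋ : ∀ {p F G} → F ≋ G → Sparse p F → Sparse p G
  Sparse-≋ F≋G F-sparse n p∤n = subst (+ _ ∣_) (F≋G n) (F-sparse n p∤n)

  Sparse-𝟙 : ∀ {p} → Sparse p 𝟙
  Sparse-𝟙 {p} zero    p∤0 = contradiction (p ∣0) p∤0
  Sparse-𝟙     (suc n) _   = divides 0ℤ refl

  Sparse-⊛ : ∀ {p F G} → Sparse p F → Sparse p G → Sparse p (F ⊛ G)
  Sparse-⊛ {p} {F} {G} F-sparse G-sparse n p∤n = ∣-⊛ n F G p∣FG
    where
    p∣FG : ∀ i j → i ℕ.+ j ≡ n → + p ∣ F i * G j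
    p∣FG i j i+j≡n with p ∣? i
    ... | no  p∤i = ∣m⇒∣m*n (G j) (F-sparse i p∤i)
    ... | yes p∣i = ∣n⇒∣m*n (F i) (G-sparse j (λ p∣j → p∤n (subst (p ℕ.∣_) i+j≡n (∣m∣n⇒∣m+n p∣i p∣j))))

  Sparse-^ : ∀ {p F} w → Sparse p F → Sparse p (F ^ w)
  Sparse-^ zero    F-sparse = Sparse-𝟙
  Sparse-^ (suc w) F-sparse = Sparse-⊛ F-sparse (Sparse-^ w F-sparse)

module GeneratingFunctions where

  open PowerSeries
  open AddingParts
  open Sparsity
  open import Data.Integer.Base using (+_; 0ℤ; 1ℤ; _+_; -_)
  import Data.Integer.Properties as ℤ
  open import Data.Integer.Divisibility.Signed using (∣ᵤ⇒∣)
  open import Data.Integer.Tactic.RingSolver using (solve-∀)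
  open import Data.Nat.Base using (ℕ; zero; suc)
  import Data.Nat.Base as ℕ
  import Data.Nat.Properties as ℕ
  open import Data.Nat.Primality using (Prime)
  open import Data.Product.Base using (_,_)
  open import Relation.Binary.PropositionalEquality using (_≡_; refl; cong; cong₂; trans; module ≡-Reasoning)
  open import Relation.Nullary.Decidable using (yes; no)

  toSeries : (ℕ → ℕ) → Series
  toSeries f n = + f n

  addPartsSeries : ℕ → ℕ → (ℕ → ℕ) → Series
  addPartsSeries d c Y = toSeries (addParts d c Y)

  addPartsSeries-shift : ∀ d c Y →
    addPartsSeries (suc d) (suc c) Y ≋ addPartsSeries (suc d) c Y ⊕ shift (suc d) (addPartsSeries (suc d) (suc c) Y)
  addPartsSeries-shift d c Y n with n ℕ.<? suc d
  ... | yes n<d = begin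
    + addParts (suc d) (suc c) Y n  ≡⟨ cong +_ (addParts-below d (suc c) Y n n<d) ⟩
    + Y n                           ≡⟨ ℤ.+-identityʳ (+ Y n) ⟨
    + Y n + 0ℤ                      ≡⟨ cong₂ _+_ (cong +_ (addParts-below d c Y n n<d)) (shift-below (suc d) _ n n<d) ⟨
    + addParts (suc d) c Y n + shift (suc d) (addPartsSeries (suc d) (suc c) Y) n ∎
    where open ≡-Reasoning
  ... | no n≮d with ℕ.m≤n⇒∃[o]m+o≡n (ℕ.≮⇒≥ n≮d)
  ...   | n′ , refl = begin
    + addParts (suc d) (suc c) Y N                               ≡⟨ cong +_ (addParts-pascal d c Y n′) ⟩
    + (addParts (suc d) c Y N ℕ.+ addParts (suc d) (suc c) Y n′)  ≡⟨ ℤ.pos-+ (addParts (suc d) c Y N) _ ⟩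
    + addParts (suc d) c Y N + addPartsSeries (suc d) (suc c) Y n′
      ≡⟨ cong (λ x → + addParts (suc d) c Y N + x) (shift-above (suc d) (addPartsSeries (suc d) (suc c) Y) n′) ⟨
    + addParts (suc d) c Y N + shift (suc d) (addPartsSeries (suc d) (suc c) Y) N ∎
    where
    open ≡-Reasoning
    N = suc d ℕ.+ n′

  1-q^⊛addPartsSeries : ∀ d c Y → (𝟙 ⊕ ⊝ q^ suc d) ⊛ addPartsSeries (suc d) (suc c) Y ≋ addPartsSeries (suc d) c Y
  1-q^⊛addPartsSeries d c Y = begin
    (𝟙 ⊕ ⊝ q^ suc d) ⊛ F                   ≈⟨ solve 2 (λ Q F → (con 1ℤ :+ :- Q) :* F := F :+ :- (Q :* F)) ≋-refl (q^ suc d) F ⟩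
    F ⊕ ⊝ (q^ suc d ⊛ F)                    ≈⟨ ⊕-cong (addPartsSeries-shift d c Y) (⊝-cong (q^-⊛ (suc d) F)) ⟩
    A ⊕ shift (suc d) F ⊕ ⊝ shift (suc d) F ≈⟨ (λ n → cancel (A n) (shift (suc d) F n)) ⟩
    A                                        ∎
    where
    open import Relation.Binary.Reasoning.Setoid ≋-setoid
    F = addPartsSeries (suc d) (suc c) Y
    A = addPartsSeries (suc d) c Y
    cancel : ∀ a b → a + b + - b ≡ a
    cancel = solve-∀

  geometric : ℕ → Series
  geometric d = addPartsSeries d 1 δ₀

  toSeries-δ₀ : toSeries δ₀ ≋ 𝟙
  toSeries-δ₀ zero    = refl
  toSeries-δ₀ (suc n) = refl

  addPartsSeries-zero : ∀ d Y → addPartsSeries (suc d) 0 Y ≋ toSeries Y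
  addPartsSeries-zero d Y n = cong +_ (addParts-zero d Y n)

  geometric⊛1-q^ : ∀ d → geometric (suc d) ⊛ (𝟙 ⊕ ⊝ q^ suc d) ≋ 𝟙
  geometric⊛1-q^ d = ≋-trans (⊛-comm (geometric (suc d)) _)
                             (≋-trans (1-q^⊛addPartsSeries d 0 δ₀) (≋-trans (addPartsSeries-zero d δ₀) toSeries-δ₀))

  addPartsSeries≋geometric^ : ∀ d c Y → addPartsSeries (suc d) c Y ≋ geometric (suc d) ^ c ⊛ toSeries Y
  addPartsSeries≋geometric^ d zero    Y = ≋-trans (addPartsSeries-zero d Y) (≋-sym (⊛-identityˡ (toSeries Y)))
  addPartsSeries≋geometric^ d (suc c) Y = begin
    A (suc c)                         ≈⟨ ⊛-identityˡ (A (suc c)) ⟨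
    𝟙 ⊛ A (suc c)                     ≈⟨ ⊛-cong (geometric⊛1-q^ d) ≋-refl ⟨
    G ⊛ (𝟙 ⊕ ⊝ q^ suc d) ⊛ A (suc c)  ≈⟨ ⊛-assoc G _ _ ⟩
    G ⊛ ((𝟙 ⊕ ⊝ q^ suc d) ⊛ A (suc c)) ≈⟨ ⊛-cong ≋-refl (1-q^⊛addPartsSeries d c Y) ⟩
    G ⊛ A c                           ≈⟨ ⊛-cong ≋-refl (addPartsSeries≋geometric^ d c Y) ⟩
    G ⊛ (G ^ c ⊛ toSeries Y)          ≈⟨ ⊛-assoc G _ _ ⟨
    G ^ suc c ⊛ toSeries Y            ∎
    where
    open import Relation.Binary.Reasoning.Setoid ≋-setoid
    G = geometric (suc d)
    A : ℕ → Series
    A c = addPartsSeries (suc d) c Y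

  geometric^prime-sparse : ∀ {p} d → Prime p → Sparse p (geometric (suc d) ^ p)
  geometric^prime-sparse {p} d p-prime =
    Sparse-≋ addPartsSeries≋geometric^p (λ n p∤n → ∣ᵤ⇒∣ (addParts-prime-sparse d n p-prime p∤n))
    where
    addPartsSeries≋geometric^p : addPartsSeries (suc d) p δ₀ ≋ geometric (suc d) ^ p
    addPartsSeries≋geometric^p = ≋-trans (addPartsSeries≋geometric^ d p δ₀)
      (≋-trans (⊛-cong ≋-refl toSeries-δ₀) (≋-trans (⊛-comm _ 𝟙) (⊛-identityˡ _)))


module Partitions where

  open PowerSeries
  open Sparsity
  open GeneratingFunctions
  open Jacobi 2 using (poch)
  open import Data.Bool.Base using (true; false; if_then_else_)
  open import Data.Integer.Base using (1ℤ)
  open import Data.Nat.Base using (ℕ; zero; suc; _+_; _*_; ⌊_/2⌋)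
  import Data.Nat.Properties as ℕ
  open import Data.Nat.Primality using (Prime)
  open import Data.Product.Base using (_×_; _,_)
  open import Data.Sum.Base using (_⊎_; inj₁; inj₂)
  open import Relation.Binary.PropositionalEquality using (_≡_; refl; cong; sym; trans)
  open import Defs using (parts; colors; even?)

  partitionSeries : ℕ → ℕ → ℕ → Series
  partitionSeries r s m = toSeries (parts r s m)

  partitionSeries-zero : ∀ r s → partitionSeries r s 0 ≋ 𝟙
  partitionSeries-zero r s zero    = refl
  partitionSeries-zero r s (suc n) = refl

  partitionSeries-suc : ∀ r s m → partitionSeries r s (suc m) ≋ geometric (suc m) ^ colors r s (suc m) ⊛ partitionSeries r s m
  partitionSeries-suc r s m = addPartsSeries≋geometric^ m (colors r s (suc m)) (parts r s m)

  partitionSeries-sparse : ∀ {p} → Prime p → ∀ u v m → Sparse p (partitionSeries (p * u) (p * v) m)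
  partitionSeries-sparse p-prime u v zero    = Sparse-≋ (≋-sym (partitionSeries-zero _ _)) Sparse-𝟙
  partitionSeries-sparse {p} p-prime u v (suc m) =
    Sparse-≋ (≋-sym (partitionSeries-suc (p * u) (p * v) m)) (Sparse-⊛ colour-factor (partitionSeries-sparse p-prime u v m))
    where
    geometric^p*-sparse : ∀ w → Sparse p (geometric (suc m) ^ (p * w))
    geometric^p*-sparse w = Sparse-≋ (^-assocʳ (geometric (suc m)) p w) (Sparse-^ w (geometric^prime-sparse m p-prime))
    colour-factor : Sparse p (geometric (suc m) ^ colors (p * u) (p * v) (suc m))
    colour-factor with even? (suc m)
    ... | true  = geometric^p*-sparse u
    ... | false = geometric^p*-sparse v

  evenCube : ℕ → Series
  evenCube zero    = 𝟙
  evenCube (suc m) = evenCube m ⊛ (if even? (suc m) then (𝟙 ⊕ ⊝ q^ suc m) ^ 3 else 𝟙)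

  geometric^[3+r]-cancel : ∀ d r X → geometric (suc d) ^ (3 + r) ⊛ (X ⊛ (𝟙 ⊕ ⊝ q^ suc d) ^ 3) ≋ geometric (suc d) ^ r ⊛ X
  geometric^[3+r]-cancel d r X = begin
    G ⊛ (G ⊛ (G ⊛ G ^ r)) ⊛ (X ⊛ F ^ 3)
      ≈⟨ solve 4 (λ G F Gr X → G :* (G :* (G :* Gr)) :* (X :* F :^ 3) := (G :* F) :^ 3 :* (Gr :* X)) ≋-refl G F (G ^ r) X ⟩
    (G ⊛ F) ^ 3 ⊛ (G ^ r ⊛ X)           ≈⟨ ⊛-cong (^-congˡ 3 (geometric⊛1-q^ d)) ≋-refl ⟩
    𝟙 ^ 3 ⊛ (G ^ r ⊛ X)                 ≈⟨ solve 1 (λ A → con 1ℤ :^ 3 :* A := A) ≋-refl (G ^ r ⊛ X) ⟩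
    G ^ r ⊛ X                           ∎
    where
    open import Relation.Binary.Reasoning.Setoid ≋-setoid
    G = geometric (suc d)
    F = 𝟙 ⊕ ⊝ q^ suc d

  partitionSeries≋[3+r]⊛evenCube : ∀ r s m → partitionSeries r s m ≋ partitionSeries (3 + r) s m ⊛ evenCube m
  partitionSeries≋[3+r]⊛evenCube r s zero    =
    ≋-trans (partitionSeries-zero r s) (≋-sym (≋-trans (⊛-cong (partitionSeries-zero (3 + r) s) ≋-refl) (⊛-identityˡ 𝟙)))
  partitionSeries≋[3+r]⊛evenCube r s (suc m) = begin
    partitionSeries r s (suc m)                                     ≈⟨ partitionSeries-suc r s m ⟩
    G ^ colors r s (suc m) ⊛ partitionSeries r s m                  ≈⟨ ⊛-cong ≋-refl (partitionSeries≋[3+r]⊛evenCube r s m) ⟩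
    G ^ colors r s (suc m) ⊛ (partitionSeries (3 + r) s m ⊛ evenCube m) ≈⟨ step ⟩
    G ^ colors (3 + r) s (suc m) ⊛ partitionSeries (3 + r) s m ⊛ evenCube (suc m) ≈⟨ ⊛-cong (partitionSeries-suc (3 + r) s m) ≋-refl ⟨
    partitionSeries (3 + r) s (suc m) ⊛ evenCube (suc m)            ∎
    where
    open import Relation.Binary.Reasoning.Setoid ≋-setoid
    G = geometric (suc m)
    P = partitionSeries (3 + r) s m
    step : G ^ colors r s (suc m) ⊛ (partitionSeries (3 + r) s m ⊛ evenCube m) ≋
           G ^ colors (3 + r) s (suc m) ⊛ partitionSeries (3 + r) s m ⊛ evenCube (suc m)
    step with even? (suc m)
    ... | true  = ≋-sym (≋-trans (⊛-assoc (G ^ (3 + r)) P _)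
                          (≋-trans (⊛-cong ≋-refl (≋-sym (⊛-assoc P (evenCube m) _))) (geometric^[3+r]-cancel m r (P ⊛ evenCube m))))
    ... | false = ≋-sym (≋-trans (⊛-assoc (G ^ s) P _)
                          (⊛-cong ≋-refl (⊛-cong ≋-refl (≋-trans (⊛-comm (evenCube m) 𝟙) (⊛-identityˡ (evenCube m))))))

  even?-suc : ∀ m → (even? (suc m) ≡ true × ⌊ suc m /2⌋ ≡ suc ⌊ m /2⌋ × 2 * suc ⌊ m /2⌋ ≡ suc m)
                    ⊎ (even? (suc m) ≡ false × ⌊ suc m /2⌋ ≡ ⌊ m /2⌋)
  even?-suc zero          = inj₂ (refl , refl)
  even?-suc (suc zero)    = inj₁ (refl , refl , refl)
  even?-suc (suc (suc m)) with even?-suc m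
  ... | inj₁ (even , ⌊/2⌋≡ , 2*≡) = inj₁ (even , cong suc ⌊/2⌋≡ , trans (ℕ.*-suc 2 (suc ⌊ m /2⌋)) (cong (2 +_) 2*≡))
  ... | inj₂ (odd , ⌊/2⌋≡)        = inj₂ (odd , cong suc ⌊/2⌋≡)

  evenCube≋poch : ∀ m → evenCube m ≋ poch 0 ⌊ m /2⌋ ^ 3
  evenCube≋poch zero    = solve 0 (con 1ℤ := con 1ℤ :^ 3) ≋-refl
  evenCube≋poch (suc m) with even?-suc m
  ... | inj₁ (even , ⌊/2⌋≡ , 2*≡) rewrite even | ⌊/2⌋≡ = begin
    evenCube m ⊛ F ^ 3                       ≈⟨ ⊛-cong (evenCube≋poch m) ≋-refl ⟩
    poch 0 ⌊ m /2⌋ ^ 3 ⊛ F ^ 3               ≈⟨ solve 2 (λ P F → P :^ 3 :* F :^ 3 := (P :* F) :^ 3) ≋-refl (poch 0 ⌊ m /2⌋) F ⟩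
    (poch 0 ⌊ m /2⌋ ⊛ F) ^ 3                 ≈⟨ ^-congˡ 3 (⊛-cong ≋-refl (≋-reflexive (cong (λ e → 𝟙 ⊕ ⊝ q^ e) (sym 2*≡)))) ⟩
    poch 0 (suc ⌊ m /2⌋) ^ 3                 ∎
    where
    open import Relation.Binary.Reasoning.Setoid ≋-setoid
    F = 𝟙 ⊕ ⊝ q^ suc m
  ... | inj₂ (odd , ⌊/2⌋≡) rewrite odd | ⌊/2⌋≡ =
    ≋-trans (≋-trans (⊛-comm (evenCube m) 𝟙) (⊛-identityˡ (evenCube m))) (evenCube≋poch m)

module Arithmetic where

  open import Data.Nat.Base using (ℕ; zero; suc; _+_; _*_; _∸_; _≤_; _<_; ⌊_/2⌋; s≤s; z≤n)
  import Data.Nat.Properties as ℕ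
  import Data.Nat.Tactic.RingSolver as ℕ-Solver
  open import Data.Product.Base using (_,_; proj₂)
  open import Relation.Binary.PropositionalEquality using (_≡_; _≢_; refl; cong; sym; trans; module ≡-Reasoning)
  open import Defs using (QNR)

  QNR⇒not-oblong : ∀ {p r} → QNR p (4 * r + 1) → ∀ n c j → p * c + j * suc j ≢ p * n + r
  QNR⇒not-oblong {p} {r} qnr n c j eq = proj₂ qnr (2 * j + 1 , 4 * c , 4 * n , (begin
    (2 * j + 1) * (2 * j + 1) + p * (4 * c) ≡⟨ square j p c ⟩
    4 * (p * c + j * suc j) + 1             ≡⟨ cong (λ t → 4 * t + 1) eq ⟩
    4 * (p * n + r) + 1                     ≡⟨ expand p n r ⟩
    4 * r + 1 + p * (4 * n)                 ∎))
    where
    open ≡-Reasoning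
    square : ∀ j p c → (2 * j + 1) * (2 * j + 1) + p * (4 * c) ≡ 4 * (p * c + j * suc j) + 1
    square = ℕ-Solver.solve-∀
    expand : ∀ p n r → 4 * (p * n + r) + 1 ≡ 4 * r + 1 + p * (4 * n)
    expand = ℕ-Solver.solve-∀

  n<2*[1+⌊n/2⌋] : ∀ n → n < 2 * suc ⌊ n /2⌋
  n<2*[1+⌊n/2⌋] zero          = s≤s z≤n
  n<2*[1+⌊n/2⌋] (suc zero)    = s≤s (s≤s z≤n)
  n<2*[1+⌊n/2⌋] (suc (suc n)) = ℕ.<-≤-trans (s≤s (s≤s (n<2*[1+⌊n/2⌋] n))) (ℕ.≤-reflexive (sym (ℕ.*-suc 2 (suc ⌊ n /2⌋))))

  3+[p*m+[p∸3]]≡p*[1+m] : ∀ {p} m → 3 ≤ p → 3 + (p * m + (p ∸ 3)) ≡ p * suc m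
  3+[p*m+[p∸3]]≡p*[1+m] {p} m 3≤p = begin
    3 + (p * m + (p ∸ 3)) ≡⟨ ℕ.+-comm 3 _ ⟩
    p * m + (p ∸ 3) + 3   ≡⟨ ℕ.+-assoc (p * m) (p ∸ 3) 3 ⟩
    p * m + (p ∸ 3 + 3)   ≡⟨ cong (p * m +_) (ℕ.m∸n+n≡m 3≤p) ⟩
    p * m + p             ≡⟨ ℕ.+-comm (p * m) p ⟩
    p + p * m             ≡⟨ ℕ.*-suc p m ⟨
    p * suc m             ∎
    where open ≡-Reasoning

  p*k+p≡p*[1+k] : ∀ p k → p * k + p ≡ p * suc k
  p*k+p≡p*[1+k] p k = trans (ℕ.+-comm (p * k) p) (sym (ℕ.*-suc p k))

module Congruence where

  open PowerSeries
  open Sparsity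
  open Arithmetic
  open TriangularNumbers
  open Jacobi 2 using (poch; jacobi-coefficient-vanishes)
  open import Data.Integer.Base using (+_; 0ℤ; _*_)
  import Data.Integer.Properties as ℤ
  open import Data.Integer.Divisibility.Signed using (_∣_; ∣m⇒∣m*n; divides)
  open import Data.Nat.Base as ℕ using (ℕ; zero; suc; _+_; _<_; _≤_)
  import Data.Nat.Properties as ℕ
  import Data.Nat.Divisibility as ℕ
  open import Relation.Binary.PropositionalEquality using (_≡_; _≢_; refl; cong; cong₂; subst; sym; trans; module ≡-Reasoning)
  open import Relation.Nullary.Decidable using (yes; no)
  open import Defs using (QNR)

  sparse⊛jacobiCube-divisible : ∀ {p r H} → QNR p (4 ℕ.* r + 1) → Sparse p H → ∀ L n → p ℕ.* n + r < 2 ℕ.* suc L →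
                                + p ∣ (H ⊛ poch 0 L ^ 3) (p ℕ.* n + r)
  sparse⊛jacobiCube-divisible {p} {r} {H} qnr H-sparse L n N< = ∣-⊛ (p ℕ.* n + r) H (poch 0 L ^ 3) p∣term
    where
    p∣term : ∀ i t → i + t ≡ p ℕ.* n + r → + p ∣ H i * (poch 0 L ^ 3) t
    p∣term i t i+t≡N with p ℕ.∣? i
    ... | no  p∤i = ∣m⇒∣m*n ((poch 0 L ^ 3) t) (H-sparse i p∤i)
    ... | yes (ℕ.divides c i≡c*p) =
      subst (λ x → + p ∣ H i * x) (sym (jacobi-coefficient-vanishes L t t< t≢2*tri)) (divides 0ℤ (ℤ.*-zeroʳ (H i)))
      where
      t< : t < 2 ℕ.* suc L
      t< = ℕ.≤-<-trans (subst (t ≤_) i+t≡N (ℕ.m≤n+m t i)) N<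
      t≢2*tri : ∀ j → t ≢ 2 ℕ.* tri j
      t≢2*tri j t≡ = QNR⇒not-oblong qnr n c j (begin
        p ℕ.* c + j ℕ.* suc j ≡⟨ cong₂ _+_ (trans (ℕ.*-comm p c) (sym i≡c*p)) (trans (sym (2*tri≡j*[1+j] j)) (sym t≡)) ⟩
        i + t                 ≡⟨ i+t≡N ⟩
        p ℕ.* n + r           ∎)
        where open ≡-Reasoning

open import Defs
open import Data.Nat using (ℕ; _+_; _*_; _∸_; _≤_)
open import Data.Nat.Divisibility using (_∣_)
open import Data.Nat.Primality using (Prime)

open import Data.Integer.Base using (+_)
open import Data.Integer.Divisibility.Signed using (∣⇒∣ᵤ) renaming (_∣_ to _∣ℤ_)
open import Data.Nat.Base using (suc; ⌊_/2⌋; s≤s; z≤n)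
import Data.Nat.Properties as ℕ
open import Relation.Binary.PropositionalEquality using (_≡_; subst; subst₂; sym; trans)
open PowerSeries
open Sparsity using (Sparse)
open Partitions
open Arithmetic
open Congruence
open Jacobi 2 using (poch)

theorem1p13 : (p r : ℕ) → Prime p → 5 ≤ p → 1 ≤ r → r ≤ p ∸ 1 → QNR p (4 * r + 1) →
    (n k j : ℕ) → j ≤ k →
    p ∣ a (p * (k ∸ j) + (p ∸ 3)) (p * k + p) (p * n + r)
theorem1p13 p r p-prime 5≤p _ _ qnr n k j _ =
  ∣⇒∣ᵤ (subst (+ p ∣ℤ_) (sym a≡coefficient) (sparse⊛jacobiCube-divisible qnr sparse ⌊ N /2⌋ n (n<2*[1+⌊n/2⌋] N)))
  where
  N = p * n + r
  R = p * (k ∸ j) + (p ∸ 3)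
  S = p * k + p
  a≡coefficient : + a R S N ≡ (partitionSeries (3 + R) S N ⊛ poch 0 ⌊ N /2⌋ ^ 3) N
  a≡coefficient = trans (partitionSeries≋[3+r]⊛evenCube R S N N) (⊛-cong ≋-refl (evenCube≋poch N) N)
  sparse : Sparse p (partitionSeries (3 + R) S N)
  sparse = subst₂ (λ u v → Sparse p (partitionSeries u v N))
                  (sym (3+[p*m+[p∸3]]≡p*[1+m] (k ∸ j) (ℕ.≤-trans (s≤s (s≤s (s≤s z≤n))) 5≤p))) (sym (p*k+p≡p*[1+k] p k))
                  (partitionSeries-sparse p-prime (suc (k ∸ j)) (suc k) N)
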